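{- Let $q=p^m$ be a power of a prime $p$, let $n,r$ be positive integers such that $d:=(nm,r)=(m,r)$, and let $c\in\mathbb{F}_q$ satisfy $N_{q|p^d}(c)=1$. Then $L_{c,r}(x):=x^{p^r}-cx$ induces a permutation of $\ker(T_{q^n|q})$ if and only if $p\nmid n$. In this case a polynomial inducing the inverse map of $L_{c,r}$ restricted to $\ker(T_{q^n|q})$ is \[\sum_{j=0}^{\frac{m}{d}-1}c^{ -\frac{p^{(j+1)r}-1}{p^r-1}}\left(n^{ -1}\sum_{k=1}^{n-1}k\,x^{p^{\frac{kmr}{d}}}\right)^{p^{jr}}.\]
   Context: For a prime power $Q$ and positive integers $b\mid a$, $T_{Q^a|Q^b}(x)=\sum_{i=0}^{a/b-1}x^{Q^{ib}}$ is the trace map $\mathbb{F}_{Q^a}\to\mathbb{F}_{Q^b}$ and $N_{Q^a|Q^b}(x)=x^{(Q^a-1)/(Q^b-1)}$ the norm map. $\ker(T_{q^n|q})\subseteq\mathbb{F}_{q^n}$ is the kernel of the trace. Integers $n,k$ are viewed in the prime field $\mathbb{F}_p$ and $n^{ -1}$ is the inverse there. -}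

module Defs where

open import Level using (Level; _⊔_)
open import Data.Nat.Base as ℕ using (ℕ; zero; suc; _∸_)
import Data.Nat.DivMod as ℕDM
open import Data.Fin.Base using (Fin)
open import Data.Product.Base using (Σ; ∃; _×_; _,_)
open import Relation.Nullary.Negation.Core using (¬_)
open import Algebra.Bundles using (CommutativeRing)
import Relation.Binary.PropositionalEquality

-- Total natural-number division (returns 0 when dividing by 0);
-- only ever applied here to nonzero divisors.
divℕ : ℕ → ℕ → ℕ
divℕ a zero    = 0
divℕ a (suc k) = a ℕ./ suc k

module FieldDefs {c ℓ : Level} (R : CommutativeRing c ℓ) where
  open CommutativeRing R

  pow : Carrier → ℕ → Carrier
  pow x zero    = 1#
  pow x (suc k) = x * pow x k

  fromℕ : ℕ → Carrier
  fromℕ zero    = 0#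
  fromℕ (suc k) = 1# + fromℕ k

  sumTo : ℕ → (ℕ → Carrier) → Carrier
  sumTo zero    f = 0#
  sumTo (suc n) f = sumTo n f + f n

  -- Trace map T_{Q^a|Q^b}(x) = ∑_{i=0}^{a/b-1} x^{Q^{ib}}
  trace : (Q a b : ℕ) → Carrier → Carrier
  trace Q a b x = sumTo (divℕ a b) (λ i → pow x (Q ℕ.^ (i ℕ.* b)))

  -- Norm map N_{Q^a|Q^b}(x) = x^{(Q^a-1)/(Q^b-1)}
  norm : (Q a b : ℕ) → Carrier → Carrier
  norm Q a b x = pow x (divℕ (Q ℕ.^ a ∸ 1) (Q ℕ.^ b ∸ 1))

  InducesPermutation : {ℓ' : Level} → (Carrier → Set ℓ') → (Carrier → Carrier) → Set (c ⊔ ℓ ⊔ ℓ')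
  InducesPermutation S f =
    (∀ x → S x → S (f x)) ×
    (∀ x y → S x → S y → f x ≈ f y → x ≈ y) ×
    (∀ y → S y → ∃ λ x → S x × f x ≈ y)

record IsFiniteField {c ℓ : Level} (R : CommutativeRing c ℓ) (N : ℕ) : Set (c ⊔ ℓ) where
  open CommutativeRing R
  field
    1≉0      : ¬ (1# ≈ 0#)
    _⁻¹      : Carrier → Carrier
    inverseʳ : ∀ x → ¬ (x ≈ 0#) → (x * (x ⁻¹)) ≈ 1#
    enum     : Fin N → Carrier
    enum-inj : ∀ i j → enum i ≈ enum j → i Relation.Binary.PropositionalEquality.≡ j
    enum-surj : ∀ x → ∃ λ i → enum i ≈ x

module PaperDefs {c ℓ : Level} (R : CommutativeRing c ℓ) where
  open CommutativeRing R
  open FieldDefs R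

  Lmap : (p r : ℕ) → Carrier → Carrier → Carrier
  Lmap p r cc x = pow x (p ℕ.^ r) - cc * x

  KerTr : (q n : ℕ) → Carrier → Set ℓ
  KerTr q n x = trace q n 1 x ≈ 0#

  invPoly : (inv : Carrier → Carrier) (p m n r d : ℕ) → Carrier → Carrier → Carrier
  invPoly inv p m n r d cc x =
    sumTo (divℕ m d) λ j →
      pow (inv cc) (divℕ (p ℕ.^ (suc j ℕ.* r) ∸ 1) (p ℕ.^ r ∸ 1))
      * pow (inner x) (p ℕ.^ (j ℕ.* r))
    where
      inner : Carrier → Carrier
      inner y = inv (fromℕ n) * sumTo (n ∸ 1) (λ i →
                  fromℕ (suc i) * pow y (p ℕ.^ divℕ (suc i ℕ.* m ℕ.* r) d))

-- With q = p ^ m, d = (m, r), m = d M and r = d s, the hypothesis (n m, r) = (m, r) makes s a unit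
-- mod n, so Φ = x ↦ x ^ (q ^ s) generates Gal(F_{q^n} | F_q); moreover M r = m s.  Telescoping shows
-- that Z = Σ_{j<M} c ^ -((p^{(j+1)r} - 1)/(p^r - 1)) x ^ (p ^ (j r)) satisfies L ∘ Z = Z ∘ L = Φ - id,
-- because c ^ ((p^{Mr} - 1)/(p^r - 1)) = N(c) = 1.  If p ∤ n, Abel summation shows that
-- U = n⁻¹ Σ_{k<n} k Φ^k inverts Φ - id on ker T, so the paper's polynomial Z ∘ U inverts L there.
-- If p ∣ n, then F_q ⊆ ker T and L ∘ Z vanishes on F_q, so injectivity of L on ker T forces Z ∘ T = 0
-- on F_{q^n}; but Z ∘ T is a polynomial of degree < q ^ n whose coefficient of x is c⁻¹ ≠ 0.

module Submission where

open import Defs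
open import Level using (Level)
open import Data.Nat.Base as ℕ using (ℕ; zero; suc; NonZero; _!)
import Data.Nat.Properties as ℕP
open import Data.Nat.Divisibility as ℕD using (_∣_; divides)
open import Data.Nat.DivMod using (_%_; _/_)
import Data.Nat.DivMod as ℕDM
open import Data.Nat.GCD using (gcd)
import Data.Nat.GCD as GCD
open import Data.Nat.Coprimality as Cop using (Coprime)
open import Data.Nat.Primality using (Prime; euclidsLemma; prime⇒nonZero; prime⇒nonTrivial; prime⇒irreducible)
open import Data.Nat.Combinatorics using (_C_; nCn≡1; k![n∸k]!∣n!)
open import Data.Nat.Combinatorics.Specification using (nCk≡n!/k![n-k]!)
open import Data.Nat.Tactic.RingSolver using (solve-∀)
open import Data.Fin.Base as Fin using (Fin; toℕ)
import Data.Fin.Properties as FinP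
open import Data.Fin.Permutation using (permutation)
open import Data.List.Base using (List; []; _∷_; length; applyUpTo)
open import Data.List.Properties using (length-applyUpTo)
open import Data.List.Relation.Unary.All.Properties using (applyUpTo⁻)
open import Data.List.Relation.Unary.All using (All; []; _∷_)
open import Data.Product.Base using (_×_; _,_; proj₁; proj₂; ∃)
open import Data.Sum.Base using (_⊎_; inj₁; inj₂)
open import Data.Empty using (⊥)
open import Relation.Nullary using (Dec; yes; no; ¬_; contradiction)
open import Relation.Binary.PropositionalEquality as PE using (_≡_; _≢_)
open import Algebra.Bundles using (CommutativeRing; CommutativeMonoid)
open import Function.Base using (_∘_)

prime⇒2≤ : ∀ {p} → Prime p → 2 ℕ.≤ p
prime⇒2≤ {p} pr = ℕ.nonTrivial⇒n>1 p {{prime⇒nonTrivial pr}}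

prime∤! : ∀ {p} → Prime p → ∀ k → k ℕ.< p → ¬ p ∣ k !
prime∤! pr zero    k<p p∣1 = ℕP.<⇒≱ (prime⇒2≤ pr) (ℕD.∣⇒≤ p∣1)
prime∤! pr (suc k) k<p p∣k! with euclidsLemma (suc k) (k !) pr p∣k!
... | inj₁ p∣1+k = ℕP.<⇒≱ k<p (ℕD.∣⇒≤ p∣1+k)
... | inj₂ p∣k!  = prime∤! pr k (ℕP.<-trans ℕP.≤-refl k<p) p∣k!

prime∣pCk : ∀ {p} → Prime p → ∀ k → 0 ℕ.< k → k ℕ.< p → p ∣ p C k
prime∣pCk {p@(suc p-1)} pr k 0<k k<p
  with euclidsLemma (k ! ℕ.* (p ℕ.∸ k) !) (p C k) pr p∣p!
  where
  p∣p! : p ∣ k ! ℕ.* (p ℕ.∸ k) ! ℕ.* (p C k)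
  p∣p! = PE.subst (p ∣_)
    (PE.sym (PE.trans (PE.cong (k ! ℕ.* (p ℕ.∸ k) ! ℕ.*_) (nCk≡n!/k![n-k]! (ℕP.<⇒≤ k<p)))
                      (ℕDM.m*[n/m]≡n {{ℕP._!*_!≢0 k (p ℕ.∸ k)}} (k![n∸k]!∣n! (ℕP.<⇒≤ k<p)))))
    (ℕD.m∣m*n (p-1 !))
... | inj₂ p∣pCk = p∣pCk
... | inj₁ p∣k![p-k]! with euclidsLemma (k !) ((p ℕ.∸ k) !) pr p∣k![p-k]!
...   | inj₁ p∣k!     = contradiction p∣k! (prime∤! pr k k<p)
...   | inj₂ p∣[p-k]! = contradiction p∣[p-k]! (prime∤! pr (p ℕ.∸ k) (ℕP.∸-monoʳ-< 0<k (ℕP.<⇒≤ k<p)))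


prime∤⇒coprime : ∀ {p k} → Prime p → ¬ p ∣ k → Coprime p k
prime∤⇒coprime pr p∤k (g∣p , g∣k) with prime⇒irreducible pr g∣p
... | inj₁ g≡1 = g≡1
... | inj₂ g≡p = contradiction (PE.subst (_∣ _) g≡p g∣k) p∤k

divℕ≡/ : ∀ a b .{{_ : NonZero b}} → divℕ a b ≡ a / b
divℕ≡/ a (suc b) = PE.refl

geom : ℕ → ℕ → ℕ
geom b zero    = 0
geom b (suc k) = geom b k ℕ.+ b ℕ.^ k

geom-suc : ∀ b k → geom b k ℕ.* b ℕ.+ 1 ≡ geom b (suc k)
geom-suc b zero    = PE.refl
geom-suc b (suc k) = begin
  (geom b k ℕ.+ b ℕ.^ k) ℕ.* b ℕ.+ 1     ≡⟨ rearrange (geom b k) (b ℕ.^ k) b ⟩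
  (geom b k ℕ.* b ℕ.+ 1) ℕ.+ b ℕ.^ suc k ≡⟨ PE.cong (ℕ._+ b ℕ.^ suc k) (geom-suc b k) ⟩
  geom b (suc k) ℕ.+ b ℕ.^ suc k         ∎
  where
  open PE.≡-Reasoning
  rearrange : ∀ g x b → (g ℕ.+ x) ℕ.* b ℕ.+ 1 ≡ (g ℕ.* b ℕ.+ 1) ℕ.+ b ℕ.* x
  rearrange = solve-∀

geom≥1 : ∀ b k → b ℕ.≥ 1 → k ℕ.≥ 1 → geom b k ℕ.≥ 1
geom≥1 b (suc k) b≥1 _ = ℕP.≤-trans (ℕP.m^n>0 b {{ℕ.>-nonZero b≥1}} k) (ℕP.m≤n+m _ (geom b k))

divℕ-pow∸1≡geom : ∀ b k → 2 ℕ.≤ b → divℕ (b ℕ.^ k ℕ.∸ 1) (b ℕ.∸ 1) ≡ geom b k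
divℕ-pow∸1≡geom (suc zero) k (ℕ.s≤s ())
divℕ-pow∸1≡geom b@(suc (suc b-2)) k _ = begin
  (b ℕ.^ k ℕ.∸ 1) / suc b-2                  ≡⟨ PE.cong (λ e → (e ℕ.∸ 1) / suc b-2) (PE.sym b^k≡) ⟩
  (geom b k ℕ.* suc b-2 ℕ.+ 1 ℕ.∸ 1) / suc b-2 ≡⟨ PE.cong (_/ suc b-2) (ℕP.m+n∸n≡m (geom b k ℕ.* suc b-2) 1) ⟩
  geom b k ℕ.* suc b-2 / suc b-2             ≡⟨ ℕDM.m*n/n≡m (geom b k) (suc b-2) ⟩
  geom b k                                   ∎
  where
  open PE.≡-Reasoning
  b^k≡ : geom b k ℕ.* suc b-2 ℕ.+ 1 ≡ b ℕ.^ k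
  b^k≡ = ℕP.+-cancelˡ-≡ (geom b k) _ _
    (PE.trans (split (geom b k) b-2) (geom-suc b k))
    where
    split : ∀ g b-2 → g ℕ.+ (g ℕ.* suc b-2 ℕ.+ 1) ≡ g ℕ.* suc (suc b-2) ℕ.+ 1
    split = solve-∀

coprime⇒∃inverse-mod : ∀ N .{{_ : NonZero N}} s → Coprime s N → ∃ λ t → (s ℕ.* t) % N ≡ 1 % N
coprime⇒∃inverse-mod N@(suc N-1) s cop with Cop.coprime-Bézout cop
... | GCD.Bézout.+- x y 1+yN≡xs = x , (begin
  (s ℕ.* x) % N       ≡⟨ PE.cong (_% N) (PE.trans (ℕP.*-comm s x) (PE.sym 1+yN≡xs)) ⟩
  (1 ℕ.+ y ℕ.* N) % N ≡⟨ ℕDM.%-remove-+ʳ 1 (ℕD.n∣m*n y) ⟩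
  1 % N               ∎)
  where open PE.≡-Reasoning
... | GCD.Bézout.-+ x y 1+xs≡yN = N-1 ℕ.* x , (begin
  (s ℕ.* (N-1 ℕ.* x)) % N               ≡⟨ PE.sym (ℕDM.%-remove-+ʳ (s ℕ.* (N-1 ℕ.* x)) (ℕD.n∣n {N})) ⟩
  (s ℕ.* (N-1 ℕ.* x) ℕ.+ N) % N         ≡⟨ PE.cong (_% N) (rearrange s N-1 x) ⟩
  (1 ℕ.+ N-1 ℕ.* (1 ℕ.+ x ℕ.* s)) % N   ≡⟨ PE.cong (λ e → (1 ℕ.+ N-1 ℕ.* e) % N) 1+xs≡yN ⟩
  (1 ℕ.+ N-1 ℕ.* (y ℕ.* N)) % N         ≡⟨ ℕDM.%-remove-+ʳ 1 (ℕD.∣-trans (ℕD.n∣m*n y) (ℕD.n∣m*n N-1)) ⟩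
  1 % N                                 ∎)
  where
  open PE.≡-Reasoning
  rearrange : ∀ s n x → s ℕ.* (n ℕ.* x) ℕ.+ suc n ≡ 1 ℕ.+ n ℕ.* (1 ℕ.+ x ℕ.* s)
  rearrange = solve-∀

[m%n*o]%n≡[m*o]%n : ∀ m o n .{{_ : NonZero n}} → ((m % n) ℕ.* o) % n ≡ (m ℕ.* o) % n
[m%n*o]%n≡[m*o]%n m o n = PE.trans (ℕDM.%-distribˡ-* (m % n) o n)
  (PE.trans (PE.cong (λ z → (z ℕ.* (o % n)) % n) (ℕDM.m%n%n≡m%n m n)) (PE.sym (ℕDM.%-distribˡ-* m o n)))

mod-inverse-cancel : ∀ n .{{_ : NonZero n}} {s t} → (s ℕ.* t) % n ≡ 1 % n →
                     ∀ i → i ℕ.< n → ((i ℕ.* t) % n ℕ.* s) % n ≡ i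
mod-inverse-cancel n {s} {t} st≡1 i i<n = begin
  ((i ℕ.* t) % n ℕ.* s) % n    ≡⟨ [m%n*o]%n≡[m*o]%n (i ℕ.* t) s n ⟩
  (i ℕ.* t ℕ.* s) % n          ≡⟨ PE.cong (_% n) (rearrange i t s) ⟩
  (s ℕ.* t ℕ.* i) % n          ≡⟨ [m%n*o]%n≡[m*o]%n (s ℕ.* t) i n ⟨
  ((s ℕ.* t) % n ℕ.* i) % n    ≡⟨ PE.cong (λ z → (z ℕ.* i) % n) st≡1 ⟩
  ((1 % n) ℕ.* i) % n          ≡⟨ [m%n*o]%n≡[m*o]%n 1 i n ⟩
  (1 ℕ.* i) % n                ≡⟨ PE.cong (_% n) (ℕP.*-identityˡ i) ⟩
  i % n                        ≡⟨ ℕDM.m<n⇒m%n≡m i<n ⟩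
  i                            ∎
  where
  open PE.≡-Reasoning
  rearrange : ∀ i t s → i ℕ.* t ℕ.* s ≡ s ℕ.* t ℕ.* i
  rearrange = solve-∀

module GcdSplitting (m r n : ℕ) (m≥1 : m ℕ.≥ 1) (gcd≡ : gcd (n ℕ.* m) r ≡ gcd m r) where
  d : ℕ
  d = gcd m r

  instance
    d≢0 : NonZero d
    d≢0 = ℕ.≢-nonZero (GCD.gcd[m,n]≢0 m r (inj₁ (λ m≡0 → ℕP.<⇒≢ m≥1 (PE.sym m≡0))))

  s M : ℕ
  s = r / d
  M = m / d

  m≡d*M : m ≡ d ℕ.* M
  m≡d*M = PE.sym (ℕDM.m*[n/m]≡n (GCD.gcd[m,n]∣m m r))

  r≡d*s : r ≡ d ℕ.* s
  r≡d*s = PE.sym (ℕDM.m*[n/m]≡n (GCD.gcd[m,n]∣n m r))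

  coprime-M-s : Coprime M s
  coprime-M-s = Cop.coprime-/gcd m r

  -- A common divisor g of s and n makes d * g a common divisor of n * m and r, hence of d.
  coprime-s-n : Coprime s n
  coprime-s-n {g} (g∣s , g∣n) = ℕD.∣1⇒≡1 (ℕD.*-cancelˡ-∣ d (PE.subst (d ℕ.* g ∣_) (PE.sym (ℕP.*-identityʳ d)) dg∣d))
    where
    dg∣d : d ℕ.* g ∣ d
    dg∣d = PE.subst (d ℕ.* g ∣_) gcd≡ (GCD.gcd-greatest
      (PE.subst (d ℕ.* g ∣_) (ℕP.*-comm m n) (ℕD.*-pres-∣ (GCD.gcd[m,n]∣m m r) g∣n))
      (PE.subst (d ℕ.* g ∣_) (PE.sym r≡d*s) (ℕD.*-monoʳ-∣ d g∣s)))

  M≥1 : M ℕ.≥ 1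
  M≥1 = ℕP.n≢0⇒n>0 (λ M≡0 → ℕP.<⇒≢ m≥1 (PE.sym (PE.trans m≡d*M (PE.trans (PE.cong (d ℕ.*_) M≡0) (ℕP.*-zeroʳ d)))))

module BigOperator {c ℓ} (M : CommutativeMonoid c ℓ) where
  open CommutativeMonoid M
  open import Algebra.Properties.CommutativeMonoid.Sum M using (sum-permute; sum-remove)
  open import Algebra.Properties.CommutativeMonoid.Sum M public using (sum; sum-cong-≋; ∑-distrib-+)
  open import Relation.Binary.Reasoning.Setoid setoid

  sum-inverses : ∀ {n} (f : Fin n → Carrier) (σ τ : Fin n → Fin n) →
                 (∀ i → σ (τ i) ≡ i) → (∀ i → τ (σ i) ≡ i) → sum f ≈ sum (f ∘ σ)
  sum-inverses f σ τ στ τσ = sum-permute f (permutation σ τ στ τσ)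

  sum-single : ∀ {n} (f : Fin n → Carrier) j → (∀ i → i ≢ j → f i ≈ ε) → sum f ≈ f j
  sum-single {suc n} f j f≈ε = trans (sum-remove {i = j} f) (trans (∙-congˡ (sum-ε (λ i → f≈ε _ (FinP.punchInᵢ≢i j i)))) (identityʳ _))
    where
    sum-ε : ∀ {n} {g : Fin n → Carrier} → (∀ i → g i ≈ ε) → sum g ≈ ε
    sum-ε {zero}  g≈ε = refl
    sum-ε {suc n} g≈ε = trans (∙-cong (g≈ε Fin.zero) (sum-ε (g≈ε ∘ Fin.suc))) (identityˡ ε)

  sum-last : ∀ n (h : Fin (suc n) → Carrier) → (∀ i → toℕ i ℕ.< n → h i ≈ ε) → sum h ≈ h (Fin.fromℕ n)
  sum-last zero    h h≈ε = identityʳ _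
  sum-last (suc n) h h≈ε = trans (∙-cong (h≈ε Fin.zero (ℕ.s≤s ℕ.z≤n))
    (sum-last n (h ∘ Fin.suc) (λ i i<n → h≈ε (Fin.suc i) (ℕ.s≤s i<n)))) (identityˡ _)

  ∏ : ℕ → (ℕ → Carrier) → Carrier
  ∏ zero    f = ε
  ∏ (suc n) f = ∏ n f ∙ f n

  ∏-cong : ∀ n {f g : ℕ → Carrier} → (∀ i → f i ≈ g i) → ∏ n f ≈ ∏ n g
  ∏-cong zero    f≈g = refl
  ∏-cong (suc n) f≈g = ∙-cong (∏-cong n f≈g) (f≈g n)

  ∏≈sum : ∀ n (f : ℕ → Carrier) → ∏ n f ≈ sum {n} (f ∘ toℕ)
  ∏≈sum zero    f = refl
  ∏≈sum (suc n) f = trans (∏-suc n f) (∙-congˡ (∏≈sum n (f ∘ suc)))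
    where
    ∏-suc : ∀ n (f : ℕ → Carrier) → ∏ (suc n) f ≈ f 0 ∙ ∏ n (f ∘ suc)
    ∏-suc zero    f = trans (identityˡ _) (sym (identityʳ _))
    ∏-suc (suc n) f = trans (∙-congʳ (∏-suc n f)) (assoc _ _ _)

  -- k ↦ k s is a permutation of ℤ/n when s is a unit mod n; its inverse is k ↦ k t.
  ∏-reindex-* : ∀ n .{{_ : NonZero n}} s → Coprime s n → (f : ℕ → Carrier) →
                (∀ k → f k ≈ f (k % n)) → ∏ n (λ k → f (k ℕ.* s)) ≈ ∏ n f
  ∏-reindex-* n s cop f f-periodic with coprime⇒∃inverse-mod n s cop
  ... | t , st≡1 = begin
    ∏ n (λ k → f (k ℕ.* s))         ≈⟨ ∏≈sum n _ ⟩
    sum {n} (λ i → f (toℕ i ℕ.* s))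
      ≈⟨ sum-cong-≋ {n} (λ i → trans (f-periodic (toℕ i ℕ.* s))
                                (reflexive (PE.cong f (PE.sym (FinP.toℕ-fromℕ< (ℕDM.m%n<n (toℕ i ℕ.* s) n)))))) ⟩
    sum {n} (λ i → f (toℕ (σ i)))   ≈⟨ sum-inverses (f ∘ toℕ) σ τ (σ∘τ st≡1) (σ∘τ ts≡1) ⟨
    sum {n} (f ∘ toℕ)               ≈⟨ ∏≈sum n f ⟨
    ∏ n f                           ∎
    where
    ts≡1 : (t ℕ.* s) % n ≡ 1 % n
    ts≡1 = PE.trans (PE.cong (_% n) (ℕP.*-comm t s)) st≡1
    mul : ℕ → Fin n → Fin n
    mul a i = Fin.fromℕ< (ℕDM.m%n<n (toℕ i ℕ.* a) n)
    σ τ : Fin n → Fin n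
    σ = mul s
    τ = mul t
    σ∘τ : ∀ {a b} → (a ℕ.* b) % n ≡ 1 % n → ∀ i → mul a (mul b i) ≡ i
    σ∘τ {a} {b} ab≡1 i = FinP.toℕ-injective (PE.trans (FinP.toℕ-fromℕ< (ℕDM.m%n<n (toℕ (mul b i) ℕ.* a) n))
      (PE.trans (PE.cong (λ z → (z ℕ.* a) % n) (FinP.toℕ-fromℕ< (ℕDM.m%n<n (toℕ i ℕ.* b) n))) (mod-inverse-cancel n ab≡1 (toℕ i) (FinP.toℕ<n i))))

module RingArithmetic {a ℓ} (R : CommutativeRing a ℓ) where
  open CommutativeRing R
  open FieldDefs R
  open import Relation.Binary.Reasoning.Setoid setoid
  open import Algebra.Properties.Ring ring using (-0#≈0#; -‿+-comm; x[y-z]≈xy-xz)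
  open import Algebra.Properties.Semiring.Exp semiring using (_^_; ^-congˡ; ^-homo-*; ^-assocʳ)
  open import Algebra.Properties.CommutativeSemiring.Exp commutativeSemiring using (^-distrib-*)
  open import Algebra.Properties.CommutativeSemiring.Binomial commutativeSemiring as Binomial using (binomialTerm)
  open import Algebra.Definitions.RawMonoid +-rawMonoid using () renaming (_×_ to _·_)
  open BigOperator *-commutativeMonoid using (∏)
  open BigOperator +-commutativeMonoid using (sum; sum-last) renaming (∏ to ∑)

  private variable
    x y : Carrier
    f g : ℕ → Carrier

  ^≈pow : ∀ x k → x ^ k ≈ pow x k
  ^≈pow x zero    = refl
  ^≈pow x (suc k) = *-congˡ (^≈pow x k)

  pow-cong : x ≈ y → ∀ k → pow x k ≈ pow y k
  pow-cong x≈y k = trans (sym (^≈pow _ k)) (trans (^-congˡ k x≈y) (^≈pow _ k))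

  pow-+ : ∀ x i j → pow x (i ℕ.+ j) ≈ pow x i * pow x j
  pow-+ x i j = trans (sym (^≈pow x (i ℕ.+ j))) (trans (^-homo-* x i j) (*-cong (^≈pow x i) (^≈pow x j)))

  pow-* : ∀ x i j → pow x (i ℕ.* j) ≈ pow (pow x i) j
  pow-* x i j = trans (sym (^≈pow x (i ℕ.* j)))
    (trans (sym (^-assocʳ x i j)) (trans (^-congˡ j (^≈pow x i)) (^≈pow (pow x i) j)))

  pow-distrib-* : ∀ x y k → pow (x * y) k ≈ pow x k * pow y k
  pow-distrib-* x y k = trans (sym (^≈pow (x * y) k)) (trans (^-distrib-* x y k) (*-cong (^≈pow x k) (^≈pow y k)))

  pow-1# : ∀ k → pow 1# k ≈ 1#
  pow-1# zero    = refl
  pow-1# (suc k) = trans (*-identityˡ _) (pow-1# k)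

  pow-geom : ∀ x b k → pow x (geom b k) ≈ ∏ k (λ i → pow x (b ℕ.^ i))
  pow-geom x b zero    = refl
  pow-geom x b (suc k) = trans (pow-+ x (geom b k) (b ℕ.^ k)) (*-congʳ (pow-geom x b k))

  fromℕ-+ : ∀ i j → fromℕ (i ℕ.+ j) ≈ fromℕ i + fromℕ j
  fromℕ-+ zero    j = sym (+-identityˡ _)
  fromℕ-+ (suc i) j = trans (+-congˡ (fromℕ-+ i j)) (sym (+-assoc _ _ _))

  fromℕ-* : ∀ i j → fromℕ (i ℕ.* j) ≈ fromℕ i * fromℕ j
  fromℕ-* zero    j = sym (zeroˡ _)
  fromℕ-* (suc i) j = begin
    fromℕ (j ℕ.+ i ℕ.* j)             ≈⟨ trans (fromℕ-+ j (i ℕ.* j)) (+-cong (sym (*-identityˡ _)) (fromℕ-* i j)) ⟩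
    1# * fromℕ j + fromℕ i * fromℕ j ≈⟨ distribʳ _ _ _ ⟨
    (1# + fromℕ i) * fromℕ j         ∎

  fromℕ-*≈0 : ∀ {j} → fromℕ j ≈ 0# → ∀ i → fromℕ (i ℕ.* j) ≈ 0#
  fromℕ-*≈0 {j} j≈0 i = trans (fromℕ-* i j) (trans (*-congˡ j≈0) (zeroʳ _))

  ·≈fromℕ* : ∀ n x → n · x ≈ fromℕ n * x
  ·≈fromℕ* zero    x = sym (zeroˡ x)
  ·≈fromℕ* (suc n) x = trans (+-cong (sym (*-identityˡ x)) (·≈fromℕ* n x)) (sym (distribʳ _ _ _))

  -- Freshman's dream: the inner binomial coefficients p C k are multiples of p.
  pow-prime-+ : ∀ {p} → Prime p → fromℕ p ≈ 0# → ∀ x y → pow (x + y) p ≈ pow x p + pow y p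
  pow-prime-+ {p@(suc p-1)} pr p≈0 x y = begin
    pow (x + y) p                                  ≈⟨ sym (^≈pow (x + y) p) ⟩
    (x + y) ^ p                                    ≈⟨ Binomial.theorem p x y ⟩
    term Fin.zero + sum (term ∘ Fin.suc)           ≈⟨ +-cong first (trans (sum-last p-1 (term ∘ Fin.suc) inner≈0) last) ⟩
    pow y p + pow x p                              ≈⟨ +-comm _ _ ⟩
    pow x p + pow y p                              ∎
    where
    term : Fin (suc p) → Carrier
    term = binomialTerm x y p
    inner≈0 : ∀ i → toℕ i ℕ.< p-1 → term (Fin.suc i) ≈ 0#
    inner≈0 i i<p-1 with prime∣pCk pr (suc (toℕ i)) (ℕ.s≤s ℕ.z≤n) (ℕ.s≤s i<p-1)
    ... | divides c pCk≡cp = begin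
      (p C suc (toℕ i)) · t                ≈⟨ ·≈fromℕ* (p C suc (toℕ i)) t ⟩
      fromℕ (p C suc (toℕ i)) * t          ≈⟨ *-congʳ (trans (reflexive (PE.cong fromℕ pCk≡cp)) (fromℕ-*≈0 p≈0 c)) ⟩
      0# * t                               ≈⟨ zeroˡ t ⟩
      0#                                   ∎
      where
      t : Carrier
      t = Binomial.binomial x y p (Fin.suc i)
    first : term Fin.zero ≈ pow y p
    first = trans (+-identityʳ _) (trans (*-identityˡ _) (^≈pow y p))
    last : term (Fin.suc (Fin.fromℕ p-1)) ≈ pow x p
    last = begin
      (p C suc (toℕ (Fin.fromℕ p-1))) · ((x ^ suc (toℕ (Fin.fromℕ p-1))) * (y ^ (p-1 ℕ.∸ toℕ (Fin.fromℕ p-1))))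
        ≈⟨ reflexive (PE.cong (λ t → (p C suc t) · ((x ^ suc t) * (y ^ (p-1 ℕ.∸ t)))) (FinP.toℕ-fromℕ p-1)) ⟩
      (p C p) · ((x ^ p) * (y ^ (p-1 ℕ.∸ p-1)))
        ≈⟨ reflexive (PE.cong₂ (λ c t → c · ((x ^ p) * (y ^ t))) (nCn≡1 p) (ℕP.n∸n≡0 p-1)) ⟩
      1 · ((x ^ p) * 1#)                   ≈⟨ trans (+-identityʳ _) (*-identityʳ _) ⟩
      x ^ p                                ≈⟨ ^≈pow x p ⟩
      pow x p                              ∎

  sumTo-cong : ∀ n → (∀ i → f i ≈ g i) → sumTo n f ≈ sumTo n g
  sumTo-cong zero    f≈g = refl
  sumTo-cong (suc n) f≈g = +-cong (sumTo-cong n f≈g) (f≈g n)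

  sumTo≈∑ : ∀ n f → sumTo n f ≈ ∑ n f
  sumTo≈∑ zero    f = refl
  sumTo≈∑ (suc n) f = +-congʳ (sumTo≈∑ n f)

  sumTo-zero : ∀ n f → (∀ i → i ℕ.< n → f i ≈ 0#) → sumTo n f ≈ 0#
  sumTo-zero zero    f f≈0 = refl
  sumTo-zero (suc n) f f≈0 =
    trans (+-cong (sumTo-zero n f (λ i i<n → f≈0 i (ℕP.m<n⇒m<1+n i<n))) (f≈0 n ℕP.≤-refl)) (+-identityˡ _)

  sumTo-+ : ∀ n f g → sumTo n (λ i → f i + g i) ≈ sumTo n f + sumTo n g
  sumTo-+ zero    f g = sym (+-identityˡ _)
  sumTo-+ (suc n) f g = begin
    sumTo n (λ i → f i + g i) + (f n + g n) ≈⟨ +-congʳ (sumTo-+ n f g) ⟩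
    (sumTo n f + sumTo n g) + (f n + g n)   ≈⟨ +-assoc _ _ _ ⟩
    sumTo n f + (sumTo n g + (f n + g n))   ≈⟨ +-congˡ (trans (sym (+-assoc _ _ _)) (trans (+-congʳ (+-comm _ _)) (+-assoc _ _ _))) ⟩
    sumTo n f + (f n + (sumTo n g + g n))   ≈⟨ +-assoc _ _ _ ⟨
    (sumTo n f + f n) + (sumTo n g + g n)   ∎

  sumTo-*ˡ : ∀ n c f → c * sumTo n f ≈ sumTo n (λ i → c * f i)
  sumTo-*ˡ zero    c f = zeroʳ c
  sumTo-*ˡ (suc n) c f = trans (distribˡ _ _ _) (+-congʳ (sumTo-*ˡ n c f))

  sumTo-*ʳ : ∀ n f c → sumTo n f * c ≈ sumTo n (λ i → f i * c)
  sumTo-*ʳ n f c = trans (*-comm _ _) (trans (sumTo-*ˡ n c f) (sumTo-cong n (λ i → *-comm _ _)))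

  sumTo-− : ∀ n f g → sumTo n (λ i → f i - g i) ≈ sumTo n f - sumTo n g
  sumTo-− n f g = trans (sumTo-+ n f (λ i → - g i)) (+-congˡ (sym (sumTo-neg n)))
    where
    sumTo-neg : ∀ n → - sumTo n g ≈ sumTo n (λ i → - g i)
    sumTo-neg zero    = -0#≈0#
    sumTo-neg (suc n) = trans (sym (-‿+-comm _ _)) (+-congʳ (sumTo-neg n))

  sumTo-const : ∀ n x → sumTo n (λ _ → x) ≈ fromℕ n * x
  sumTo-const zero    x = sym (zeroˡ x)
  sumTo-const (suc n) x = begin
    sumTo n (λ _ → x) + x    ≈⟨ +-cong (sumTo-const n x) (sym (*-identityˡ x)) ⟩
    fromℕ n * x + 1# * x     ≈⟨ distribʳ _ _ _ ⟨
    (fromℕ n + 1#) * x       ≈⟨ *-congʳ (+-comm _ _) ⟩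
    (1# + fromℕ n) * x       ∎

  sumTo-suc : ∀ n f → sumTo (suc n) f ≈ f 0 + sumTo n (f ∘ suc)
  sumTo-suc zero    f = trans (+-identityˡ _) (sym (+-identityʳ _))
  sumTo-suc (suc n) f = trans (+-congʳ (sumTo-suc n f)) (+-assoc _ _ _)

  sumTo-head : ∀ n f → 1 ℕ.≤ n → (∀ {i} → 0 ℕ.< i → i ℕ.< n → f i ≈ 0#) → sumTo n f ≈ f 0
  sumTo-head (suc n) f _ tail≈0 = trans (sumTo-suc n f)
    (trans (+-congˡ (sumTo-zero n _ (λ i i<n → tail≈0 (ℕ.s≤s ℕ.z≤n) (ℕ.s≤s i<n)))) (+-identityʳ _))

  sumTo-comm : ∀ n k (h : ℕ → ℕ → Carrier) →
               sumTo n (λ i → sumTo k (h i)) ≈ sumTo k (λ j → sumTo n (λ i → h i j))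
  sumTo-comm zero    k h = sym (sumTo-zero k _ (λ _ _ → refl))
  sumTo-comm (suc n) k h = trans (+-congʳ (sumTo-comm n k h)) (sym (sumTo-+ k _ _))

  monomial : ℕ → Carrier → ℕ → Carrier
  monomial t a k with k ℕP.≟ t
  ... | yes _ = a
  ... | no _  = 0#

  monomial-≢ : ∀ {t k} a → k ≢ t → monomial t a k ≈ 0#
  monomial-≢ {t} {k} a k≢t with k ℕP.≟ t
  ... | yes k≡t = contradiction k≡t k≢t
  ... | no _    = refl

  monomial-≡ : ∀ t a → monomial t a t ≈ a
  monomial-≡ t a with t ℕP.≟ t
  ... | yes _   = refl
  ... | no t≢t  = contradiction PE.refl t≢t

  sumTo-monomial : ∀ D t a (g : ℕ → Carrier) → t ℕ.< D → sumTo D (λ k → monomial t a k * g k) ≈ a * g t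
  sumTo-monomial (suc D) t a g t<1+D with t ℕP.≟ D
  ... | yes PE.refl = begin
    sumTo D (λ k → monomial t a k * g k) + monomial t a t * g t
      ≈⟨ +-cong (sumTo-zero D _ (λ k k<t → trans (*-congʳ (monomial-≢ a (ℕP.<⇒≢ k<t))) (zeroˡ _))) (*-congʳ (monomial-≡ t a)) ⟩
    0# + a * g t    ≈⟨ +-identityˡ _ ⟩
    a * g t         ∎
  ... | no t≢D = trans (+-cong (sumTo-monomial D t a g (ℕP.≤∧≢⇒< (ℕP.≤-pred t<1+D) t≢D))
                               (trans (*-congʳ (monomial-≢ a (t≢D ∘ PE.sym))) (zeroˡ _))) (+-identityʳ _)

  sumTo-telescope : ∀ n (b : ℕ → Carrier) → sumTo n (λ i → b (suc i) - b i) ≈ b n - b 0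
  sumTo-telescope zero    b = sym (-‿inverseʳ _)
  sumTo-telescope (suc n) b = begin
    sumTo n (λ i → b (suc i) - b i) + (b (suc n) - b n) ≈⟨ +-congʳ (sumTo-telescope n b) ⟩
    (b n - b 0) + (b (suc n) - b n)                      ≈⟨ +-comm _ _ ⟩
    (b (suc n) - b n) + (b n - b 0)                      ≈⟨ +-assoc _ _ _ ⟩
    b (suc n) + (- b n + (b n - b 0))                    ≈⟨ +-congˡ (sym (+-assoc _ _ _)) ⟩
    b (suc n) + ((- b n + b n) - b 0)                    ≈⟨ +-congˡ (trans (+-congʳ (-‿inverseˡ _)) (+-identityˡ _)) ⟩
    b (suc n) - b 0                                      ∎

  sumTo-weighted-telescope : ∀ n (b : ℕ → Carrier) →
    sumTo n (λ i → fromℕ (suc i) * (b (suc i) - b i)) ≈ fromℕ n * b n - sumTo n b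
  sumTo-weighted-telescope n b = begin
    sumTo n (λ i → fromℕ (suc i) * (b (suc i) - b i))               ≈⟨ sumTo-cong n (λ i → term (fromℕ i) (b (suc i)) (b i)) ⟩
    sumTo n (λ i → (fromℕ (suc i) * b (suc i) - fromℕ i * b i) - b i) ≈⟨ sumTo-− n _ _ ⟩
    sumTo n (λ i → fromℕ (suc i) * b (suc i) - fromℕ i * b i) - sumTo n b ≈⟨ +-congʳ (sumTo-telescope n (λ i → fromℕ i * b i)) ⟩
    (fromℕ n * b n - 0# * b 0) - sumTo n b                             ≈⟨ +-congʳ (+-congˡ (trans (-‿cong (zeroˡ _)) -0#≈0#)) ⟩
    (fromℕ n * b n + 0#) - sumTo n b                                   ≈⟨ +-congʳ (+-identityʳ _) ⟩
    fromℕ n * b n - sumTo n b                                          ∎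
    where
    term : ∀ k x y → (1# + k) * (x - y) ≈ ((1# + k) * x - k * y) - y
    term k x y = begin
      (1# + k) * (x - y)           ≈⟨ x[y-z]≈xy-xz _ _ _ ⟩
      (1# + k) * x - (1# + k) * y  ≈⟨ +-congˡ (-‿cong (trans (distribʳ _ _ _) (+-congʳ (*-identityˡ y)))) ⟩
      (1# + k) * x - (y + k * y)   ≈⟨ +-congˡ (trans (sym (-‿+-comm _ _)) (+-comm _ _)) ⟩
      (1# + k) * x + (- (k * y) - y) ≈⟨ +-assoc _ _ _ ⟨
      ((1# + k) * x - k * y) - y   ∎

module FiniteField {a ℓ} {R : CommutativeRing a ℓ} {N : ℕ} (F : IsFiniteField R N) where
  open CommutativeRing R
  open FieldDefs R
  open RingArithmetic R
  open IsFiniteField F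
  open import Relation.Binary.Reasoning.Setoid setoid
  open import Algebra.Properties.Ring ring using (x∙y⁻¹≈ε⇒x≈y)
  open BigOperator *-commutativeMonoid using (sum-inverses; sum-single; sum-cong-≋) renaming (sum to prod; ∑-distrib-+ to prod-distrib)

  private variable
    x y z : Carrier

  index : Carrier → Fin N
  index x = proj₁ (enum-surj x)

  enum-index : ∀ x → enum (index x) ≈ x
  enum-index x = proj₂ (enum-surj x)

  index-cong : x ≈ y → index x ≡ index y
  index-cong {x} {y} x≈y = enum-inj _ _ (trans (enum-index x) (trans x≈y (sym (enum-index y))))

  index-enum : ∀ i → index (enum i) ≡ i
  index-enum i = enum-inj _ _ (enum-index (enum i))

  _≈?_ : ∀ x y → Dec (x ≈ y)
  x ≈? y with index x FinP.≟ index y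
  ... | yes i≡j = yes (trans (sym (enum-index x)) (trans (reflexive (PE.cong enum i≡j)) (enum-index y)))
  ... | no i≢j  = no (i≢j ∘ index-cong)

  inverseˡ : ∀ x → ¬ x ≈ 0# → (x ⁻¹) * x ≈ 1#
  inverseˡ x x≉0 = trans (*-comm _ _) (inverseʳ x x≉0)

  *-cancelˡ : ¬ x ≈ 0# → x * y ≈ x * z → y ≈ z
  *-cancelˡ {x} {y} {z} x≉0 xy≈xz = begin
    y                  ≈⟨ trans (sym (*-identityˡ y)) (*-congʳ (sym (inverseˡ x x≉0))) ⟩
    ((x ⁻¹) * x) * y   ≈⟨ trans (*-assoc _ _ _) (trans (*-congˡ xy≈xz) (sym (*-assoc _ _ _))) ⟩
    ((x ⁻¹) * x) * z   ≈⟨ trans (*-congʳ (inverseˡ x x≉0)) (*-identityˡ z) ⟩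
    z                  ∎

  x*y≈0⇒x≈0⊎y≈0 : x * y ≈ 0# → x ≈ 0# ⊎ y ≈ 0#
  x*y≈0⇒x≈0⊎y≈0 {x} {y} xy≈0 with x ≈? 0#
  ... | yes x≈0 = inj₁ x≈0
  ... | no x≉0  = inj₂ (*-cancelˡ x≉0 (trans xy≈0 (sym (zeroʳ x))))

  x≉0∧y≉0⇒x*y≉0 : ¬ x ≈ 0# → ¬ y ≈ 0# → ¬ x * y ≈ 0#
  x≉0∧y≉0⇒x*y≉0 x≉0 y≉0 xy≈0 with x*y≈0⇒x≈0⊎y≈0 xy≈0
  ... | inj₁ x≈0 = x≉0 x≈0
  ... | inj₂ y≈0 = y≉0 y≈0

  scale : Carrier → Fin N → Fin N
  scale a i = index (a * enum i)

  scale-inverse : ∀ a b → a * b ≈ 1# → ∀ i → scale a (scale b i) ≡ i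
  scale-inverse a b ab≈1 i = PE.trans (index-cong (begin
    a * enum (index (b * enum i)) ≈⟨ *-congˡ (enum-index _) ⟩
    a * (b * enum i)              ≈⟨ sym (*-assoc _ _ _) ⟩
    (a * b) * enum i              ≈⟨ trans (*-congʳ ab≈1) (*-identityˡ _) ⟩
    enum i                        ∎)) (index-enum i)

  prod-≉0 : ∀ {n} (f : Fin n → Carrier) → (∀ i → ¬ f i ≈ 0#) → ¬ prod f ≈ 0#
  prod-≉0 {zero}  f f≉0 = 1≉0
  prod-≉0 {suc n} f f≉0 = x≉0∧y≉0⇒x*y≉0 (f≉0 Fin.zero) (prod-≉0 (f ∘ Fin.suc) (f≉0 ∘ Fin.suc))

  prod-const : ∀ n x → prod {n} (λ _ → x) ≈ pow x n
  prod-const zero    x = refl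
  prod-const (suc n) x = *-congˡ (prod-const n x)

  -- Scaling by x commutes with unit except at 0, where correction x compensates.
  unit : Carrier → Carrier
  unit y with y ≈? 0#
  ... | yes _ = 1#
  ... | no _  = y

  correction : Carrier → Carrier → Carrier
  correction x y with y ≈? 0#
  ... | yes _ = x ⁻¹
  ... | no _  = 1#

  unit≉0 : ∀ y → ¬ unit y ≈ 0#
  unit≉0 y with y ≈? 0#
  ... | yes _  = 1≉0
  ... | no y≉0 = y≉0

  unit-scale : ¬ x ≈ 0# → ∀ y → unit (enum (index (x * y))) ≈ (x * unit y) * correction x y
  unit-scale {x} x≉0 y with enum (index (x * y)) ≈? 0# | y ≈? 0#
  ... | yes _    | yes _   = sym (trans (*-congʳ (*-identityʳ x)) (inverseʳ x x≉0))
  ... | yes xy≈0 | no y≉0  = contradiction (trans (sym (enum-index _)) xy≈0) (x≉0∧y≉0⇒x*y≉0 x≉0 y≉0)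
  ... | no xy≉0  | yes y≈0 = contradiction (trans (enum-index _) (trans (*-congˡ y≈0) (zeroʳ x))) xy≉0
  ... | no _     | no _    = trans (enum-index _) (sym (*-identityʳ _))

  prod-correction : ∀ x → prod (correction x ∘ enum) ≈ x ⁻¹
  prod-correction x = trans (sum-single (correction x ∘ enum) (index 0#) away-from-0) (at-0 (enum-index 0#))
    where
    away-from-0 : ∀ i → i ≢ index 0# → correction x (enum i) ≈ 1#
    away-from-0 i i≢0 with enum i ≈? 0#
    ... | yes eᵢ≈0 = contradiction (enum-inj _ _ (trans eᵢ≈0 (sym (enum-index 0#)))) i≢0
    ... | no _     = refl
    at-0 : ∀ {y} → y ≈ 0# → correction x y ≈ x ⁻¹
    at-0 {y} y≈0 with y ≈? 0#
    ... | yes _  = refl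
    ... | no y≉0 = contradiction y≈0 y≉0

  -- Lagrange: scaling by x ≉ 0 permutes the field, so it fixes P = ∏ unit, yet multiplies it by x ^ N x ⁻¹.
  x^N≈x : ∀ x → pow x N ≈ x
  x^N≈x x with x ≈? 0#
  ... | yes x≈0 = pow-zero (index x)
    where
    pow-zero : ∀ {N} → Fin N → pow x N ≈ x
    pow-zero {suc N} _ = trans (*-congʳ x≈0) (trans (zeroˡ _) (sym x≈0))
  ... | no x≉0 = sym (*-cancelˡ (prod-≉0 (unit ∘ enum) (unit≉0 ∘ enum)) (begin
    P * x                                           ≈⟨ *-congʳ (sum-inverses (unit ∘ enum) (scale x) (scale (x ⁻¹))
                                                         (scale-inverse x (x ⁻¹) (inverseʳ x x≉0)) (scale-inverse (x ⁻¹) x (inverseˡ x x≉0))) ⟩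
    prod (λ i → unit (enum (scale x i))) * x        ≈⟨ *-congʳ (sum-cong-≋ {N} (λ i → unit-scale x≉0 (enum i))) ⟩
    prod (λ i → (x * unit (enum i)) * correction x (enum i)) * x
      ≈⟨ *-congʳ (trans (prod-distrib (λ i → x * unit (enum i)) (correction x ∘ enum))
           (*-cong (trans (prod-distrib {N} (λ _ → x) (unit ∘ enum)) (*-congʳ (prod-const N x))) (prod-correction x))) ⟩
    ((pow x N * P) * (x ⁻¹)) * x                    ≈⟨ trans (*-assoc _ _ _) (trans (*-congˡ (inverseˡ x x≉0)) (*-identityʳ _)) ⟩
    pow x N * P                                     ≈⟨ *-comm _ _ ⟩
    P * pow x N                                     ∎))
    where
    P : Carrier
    P = prod (unit ∘ enum)

  horner : List Carrier → Carrier → Carrier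
  horner []       x = 0#
  horner (a ∷ as) x = a + x * horner as x

  divide : Carrier → List Carrier → List Carrier × Carrier
  divide α []                = [] , 0#
  divide α (a ∷ [])          = [] , a
  divide α (a ∷ as@(_ ∷ _)) with divide α as
  ... | q , ρ = (ρ ∷ q) , a + α * ρ

  horner-divide : ∀ α l x → let (q , ρ) = divide α l in horner l x ≈ (x - α) * horner q x + ρ
  horner-divide α []       x = sym (trans (+-identityʳ _) (zeroʳ _))
  horner-divide α (a ∷ []) x =
    trans (+-congˡ (zeroʳ x)) (trans (+-identityʳ a) (sym (trans (+-congʳ (zeroʳ _)) (+-identityˡ a))))
  horner-divide α (a ∷ as@(_ ∷ _)) x with divide α as | horner-divide α as x
  ... | q , ρ | as≈ = begin
    a + x * horner as x                            ≈⟨ +-congˡ (*-congˡ as≈) ⟩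
    a + x * ((x - α) * horner q x + ρ)             ≈⟨ +-congˡ (distribˡ _ _ _) ⟩
    a + (x * ((x - α) * horner q x) + x * ρ)       ≈⟨ +-congˡ (+-cong (x*[y*z]≈y*[x*z] _ _ _) (sym x-α+α)) ⟩
    a + ((x - α) * (x * horner q x) + ((x - α) * ρ + α * ρ)) ≈⟨ regroup _ _ _ _ ⟩
    ((x - α) * ρ + (x - α) * (x * horner q x)) + (a + α * ρ) ≈⟨ +-congʳ (sym (distribˡ _ _ _)) ⟩
    (x - α) * (ρ + x * horner q x) + (a + α * ρ)   ∎
    where
    x*[y*z]≈y*[x*z] : ∀ x y z → x * (y * z) ≈ y * (x * z)
    x*[y*z]≈y*[x*z] x y z = trans (sym (*-assoc _ _ _)) (trans (*-congʳ (*-comm _ _)) (*-assoc _ _ _))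
    x-α+α : (x - α) * ρ + α * ρ ≈ x * ρ
    x-α+α = trans (sym (distribʳ _ _ _)) (*-congʳ (trans (+-assoc _ _ _) (trans (+-congˡ (-‿inverseˡ α)) (+-identityʳ x))))
    regroup : ∀ a u v w → a + (u + (v + w)) ≈ (v + u) + (a + w)
    regroup a u v w = begin
      a + (u + (v + w)) ≈⟨ +-congˡ (trans (sym (+-assoc _ _ _)) (+-congʳ (+-comm u v))) ⟩
      a + ((v + u) + w) ≈⟨ trans (sym (+-assoc _ _ _)) (+-congʳ (+-comm _ _)) ⟩
      ((v + u) + a) + w ≈⟨ +-assoc _ _ _ ⟩
      (v + u) + (a + w) ∎

  length-divide : ∀ α l → length (proj₁ (divide α l)) ≡ length l ℕ.∸ 1
  length-divide α []               = PE.refl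
  length-divide α (a ∷ [])         = PE.refl
  length-divide α (a ∷ as@(_ ∷ _)) = PE.cong suc (length-divide α as)

  divide-zero : ∀ α l → let (q , ρ) = divide α l in All (_≈ 0#) q → ρ ≈ 0# → All (_≈ 0#) l
  divide-zero α []       _ _   = []
  divide-zero α (a ∷ []) _ a≈0 = a≈0 ∷ []
  divide-zero α (a ∷ as@(_ ∷ _)) with divide α as | divide-zero α as
  ... | q , ρ | as≈0 = λ { (ρ≈0 ∷ q≈0) a+αρ≈0 →
    trans (sym (trans (+-congˡ (trans (*-congˡ ρ≈0) (zeroʳ α))) (+-identityʳ a))) a+αρ≈0 ∷ as≈0 q≈0 ρ≈0 }

  vanishing-at-distinct⇒zero : ∀ D l → length l ≡ D → (pts : Fin D → Carrier) →
    (∀ i j → pts i ≈ pts j → i ≡ j) → (∀ i → horner l (pts i) ≈ 0#) → All (_≈ 0#) l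
  vanishing-at-distinct⇒zero zero    []      _   pts inj vanish = []
  vanishing-at-distinct⇒zero (suc D) l@(_ ∷ _) len pts inj vanish = divide-zero α l q≈0 ρ≈0
    where
    α ρ : Carrier
    α = pts Fin.zero
    ρ = proj₂ (divide α l)
    q : List Carrier
    q = proj₁ (divide α l)
    ρ≈0 : ρ ≈ 0#
    ρ≈0 = begin
      ρ                     ≈⟨ trans (sym (+-identityˡ ρ)) (+-congʳ (sym (trans (*-congʳ (-‿inverseʳ α)) (zeroˡ _)))) ⟩
      (α - α) * horner q α + ρ ≈⟨ horner-divide α l α ⟨
      horner l α            ≈⟨ vanish Fin.zero ⟩
      0#                    ∎
    q-vanish : ∀ i → horner q (pts (Fin.suc i)) ≈ 0#
    q-vanish i with x*y≈0⇒x≈0⊎y≈0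
      (trans (sym (+-identityʳ _)) (trans (sym (trans (horner-divide α l _) (+-congˡ ρ≈0))) (vanish (Fin.suc i))))
    ... | inj₁ pᵢ-α≈0 = contradiction (inj _ _ (x∙y⁻¹≈ε⇒x≈y _ _ pᵢ-α≈0)) (λ ())
    ... | inj₂ q≈0    = q≈0
    q≈0 : All (_≈ 0#) q
    q≈0 = vanishing-at-distinct⇒zero D q (PE.trans (length-divide α l) (ℕP.suc-injective len))
      (pts ∘ Fin.suc) (λ i j e → FinP.suc-injective (inj _ _ e)) q-vanish

  horner-applyUpTo : ∀ D f x → horner (applyUpTo f D) x ≈ sumTo D (λ k → f k * pow x k)
  horner-applyUpTo zero    f x = refl
  horner-applyUpTo (suc D) f x = begin
    f 0 + x * horner (applyUpTo (f ∘ suc) D) x                ≈⟨ +-cong (sym (*-identityʳ _)) (*-congˡ (horner-applyUpTo D (f ∘ suc) x)) ⟩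
    f 0 * pow x 0 + x * sumTo D (λ k → f (suc k) * pow x k)
      ≈⟨ +-congˡ (trans (sumTo-*ˡ D x _) (sumTo-cong D (λ k → trans (sym (*-assoc _ _ _)) (trans (*-congʳ (*-comm _ _)) (*-assoc _ _ _))))) ⟩
    f 0 * pow x 0 + sumTo D (λ k → f (suc k) * pow x (suc k))  ≈⟨ sumTo-suc D _ ⟨
    sumTo (suc D) (λ k → f k * pow x k)                         ∎

  vanishing-polynomial⇒zero : (f : ℕ → Carrier) → (∀ x → sumTo N (λ k → f k * pow x k) ≈ 0#) →
                              ∀ {k} → k ℕ.< N → f k ≈ 0#
  vanishing-polynomial⇒zero f vanish = applyUpTo⁻ f N
    (vanishing-at-distinct⇒zero N (applyUpTo f N) (length-applyUpTo f N) enum enum-inj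
      (λ i → trans (horner-applyUpTo N f (enum i)) (vanish (enum i))))

module Characteristic {a ℓ} (R : CommutativeRing a ℓ) {p : ℕ} (pr : Prime p)
                      (p≈0 : CommutativeRing._≈_ R (FieldDefs.fromℕ R p) (CommutativeRing.0# R)) where
  open CommutativeRing R
  open FieldDefs R
  open RingArithmetic R
  open import Relation.Binary.Reasoning.Setoid setoid
  open import Algebra.Properties.Ring ring using (x+x≈x⇒x≈0; +-inverseʳ-unique)

  private variable
    x y : Carrier

  p∣k⇒fromℕ≈0 : ∀ {k} → p ∣ k → fromℕ k ≈ 0#
  p∣k⇒fromℕ≈0 (divides q PE.refl) = fromℕ-*≈0 p≈0 q

  private
    fromℕ-1+*≈1 : ∀ {j} i → fromℕ j ≈ 0# → fromℕ (1 ℕ.+ i ℕ.* j) ≈ 1#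
    fromℕ-1+*≈1 i j≈0 = trans (+-congˡ (fromℕ-*≈0 j≈0 i)) (+-identityʳ 1#)

  p∤k⇒fromℕ≉0 : ¬ 1# ≈ 0# → ∀ {k} → ¬ p ∣ k → ¬ fromℕ k ≈ 0#
  p∤k⇒fromℕ≉0 1≉0 {k} p∤k k≈0 with Cop.coprime-Bézout (prime∤⇒coprime pr p∤k)
  ... | GCD.Bézout.+- x y 1+yk≡xp = 1≉0 (trans (sym (fromℕ-1+*≈1 y k≈0)) (trans (reflexive (PE.cong fromℕ 1+yk≡xp)) (fromℕ-*≈0 p≈0 x)))
  ... | GCD.Bézout.-+ x y 1+xp≡yk = 1≉0 (trans (sym (fromℕ-1+*≈1 x p≈0)) (trans (reflexive (PE.cong fromℕ 1+xp≡yk)) (fromℕ-*≈0 k≈0 y)))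


  frob : ℕ → Carrier → Carrier
  frob k x = pow x (p ℕ.^ k)

  frob-cong : ∀ k → x ≈ y → frob k x ≈ frob k y
  frob-cong k x≈y = pow-cong x≈y (p ℕ.^ k)

  frob-∘ : ∀ i j x → frob (i ℕ.+ j) x ≈ frob j (frob i x)
  frob-∘ i j x = trans (reflexive (PE.cong (pow x) (ℕP.^-distribˡ-+-* p i j))) (pow-* x (p ℕ.^ i) (p ℕ.^ j))

  frob-comm : ∀ i j x → frob i (frob j x) ≈ frob j (frob i x)
  frob-comm i j x = trans (sym (frob-∘ j i x)) (trans (reflexive (PE.cong (λ k → frob k x) (ℕP.+-comm j i))) (frob-∘ i j x))

  frob-identity : ∀ x → frob 0 x ≈ x
  frob-identity = *-identityʳ

  frob-+ : ∀ k x y → frob k (x + y) ≈ frob k x + frob k y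
  frob-+ zero    x y = trans (frob-identity _) (sym (+-cong (frob-identity x) (frob-identity y)))
  frob-+ (suc k) x y = begin
    frob (1 ℕ.+ k) (x + y)              ≈⟨ frob-∘ 1 k (x + y) ⟩
    frob k (frob 1 (x + y))             ≈⟨ frob-cong k (trans (frob₁ _) (trans (pow-prime-+ pr p≈0 x y) (sym (+-cong (frob₁ x) (frob₁ y))))) ⟩
    frob k (frob 1 x + frob 1 y)        ≈⟨ frob-+ k _ _ ⟩
    frob k (frob 1 x) + frob k (frob 1 y) ≈⟨ sym (+-cong (frob-∘ 1 k x) (frob-∘ 1 k y)) ⟩
    frob (suc k) x + frob (suc k) y     ∎
    where
    frob₁ : ∀ x → frob 1 x ≈ pow x p
    frob₁ x = reflexive (PE.cong (pow x) (ℕP.*-identityʳ p))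

  frob-* : ∀ k x y → frob k (x * y) ≈ frob k x * frob k y
  frob-* k x y = pow-distrib-* x y (p ℕ.^ k)

  frob-0# : ∀ k → frob k 0# ≈ 0#
  frob-0# k = x+x≈x⇒x≈0 _ (sym (trans (frob-cong k (sym (+-identityʳ 0#))) (frob-+ k 0# 0#)))

  frob-1# : ∀ k → frob k 1# ≈ 1#
  frob-1# k = pow-1# (p ℕ.^ k)

  frob-− : ∀ k x y → frob k (x - y) ≈ frob k x - frob k y
  frob-− k x y = trans (frob-+ k x (- y)) (+-congˡ (+-inverseʳ-unique _ _ (begin
    frob k y + frob k (- y) ≈⟨ sym (frob-+ k y (- y)) ⟩
    frob k (y - y)          ≈⟨ trans (frob-cong k (-‿inverseʳ y)) (frob-0# k) ⟩
    0#                      ∎)))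

  frob-fromℕ : ∀ k j → frob k (fromℕ j) ≈ fromℕ j
  frob-fromℕ k zero    = frob-0# k
  frob-fromℕ k (suc j) = trans (frob-+ k 1# (fromℕ j)) (+-cong (frob-1# k) (frob-fromℕ k j))

  frob-sumTo : ∀ k n f → frob k (sumTo n f) ≈ sumTo n (λ i → frob k (f i))
  frob-sumTo k zero    f = frob-0# k
  frob-sumTo k (suc n) f = trans (frob-+ k _ _) (+-congʳ (frob-sumTo k n f))

  frob-pow : ∀ k x e → frob k (pow x e) ≈ pow (frob k x) e
  frob-pow k x zero    = frob-1# k
  frob-pow k x (suc e) = trans (frob-* k x (pow x e)) (*-congˡ (frob-pow k x e))

  frob-periodic : ∀ {P x} → frob P x ≈ x → ∀ q j → frob (q ℕ.* P ℕ.+ j) x ≈ frob j x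
  frob-periodic         fixed zero    j = refl
  frob-periodic {P} {x} fixed (suc q) j = begin
    frob (P ℕ.+ q ℕ.* P ℕ.+ j) x   ≈⟨ reflexive (PE.cong (λ e → frob e x) (ℕP.+-assoc P (q ℕ.* P) j)) ⟩
    frob (P ℕ.+ (q ℕ.* P ℕ.+ j)) x ≈⟨ frob-∘ P _ x ⟩
    frob (q ℕ.* P ℕ.+ j) (frob P x) ≈⟨ frob-cong (q ℕ.* P ℕ.+ j) fixed ⟩
    frob (q ℕ.* P ℕ.+ j) x         ≈⟨ frob-periodic fixed q j ⟩
    frob j x                       ∎

  frob-multiple : ∀ {P x} → frob P x ≈ x → ∀ q → frob (q ℕ.* P) x ≈ x
  frob-multiple {P} {x} fixed q = begin
    frob (q ℕ.* P) x         ≈⟨ reflexive (PE.cong (λ e → frob e x) (PE.sym (ℕP.+-identityʳ (q ℕ.* P)))) ⟩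
    frob (q ℕ.* P ℕ.+ 0) x   ≈⟨ frob-periodic fixed q 0 ⟩
    frob 0 x                 ≈⟨ frob-identity x ⟩
    x                        ∎

  frob-% : ∀ {P x} .{{_ : NonZero P}} → frob P x ≈ x → ∀ k → frob k x ≈ frob (k % P) x
  frob-% {P} {x} fixed k = begin
    frob k x                         ≈⟨ reflexive (PE.cong (λ e → frob e x) (PE.trans (ℕDM.m≡m%n+[m/n]*n k P) (ℕP.+-comm (k % P) _))) ⟩
    frob ((k / P) ℕ.* P ℕ.+ k % P) x ≈⟨ frob-periodic fixed (k / P) (k % P) ⟩
    frob (k % P) x                   ∎

  frob-*-% : ∀ {D Q x} .{{_ : NonZero Q}} → frob (D ℕ.* Q) x ≈ x → ∀ t → frob (D ℕ.* t) x ≈ frob (D ℕ.* (t % Q)) x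
  frob-*-% {D} {Q} {x} fixed t = begin
    frob (D ℕ.* t) x                                   ≈⟨ reflexive (PE.cong (λ e → frob e x) split) ⟩
    frob ((t / Q) ℕ.* (D ℕ.* Q) ℕ.+ D ℕ.* (t % Q)) x   ≈⟨ frob-periodic fixed (t / Q) _ ⟩
    frob (D ℕ.* (t % Q)) x                             ∎
    where
    rearrange : ∀ D a b Q → D ℕ.* (a ℕ.+ b ℕ.* Q) ≡ b ℕ.* (D ℕ.* Q) ℕ.+ D ℕ.* a
    rearrange = solve-∀
    split : D ℕ.* t ≡ (t / Q) ℕ.* (D ℕ.* Q) ℕ.+ D ℕ.* (t % Q)
    split = PE.trans (PE.cong (D ℕ.*_) (ℕDM.m≡m%n+[m/n]*n t Q)) (rearrange D (t % Q) (t / Q) Q)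

-- n is passed as suc n-1 so that the bound n ∸ 1 of the inner sum of invPoly computes.
module TraceKernel {a ℓ} (R : CommutativeRing a ℓ) (p m n-1 r : ℕ) (pr : Prime p)
  (m≥1 : m ℕ.≥ 1) (r≥1 : r ℕ.≥ 1) (gcd≡ : gcd (suc n-1 ℕ.* m) r ≡ gcd m r)
  (F : IsFiniteField R ((p ℕ.^ m) ℕ.^ suc n-1))
  (p≈0 : CommutativeRing._≈_ R (FieldDefs.fromℕ R p) (CommutativeRing.0# R))
  (c : CommutativeRing.Carrier R)
  (c∈Fq : CommutativeRing._≈_ R (FieldDefs.pow R c (p ℕ.^ m)) c)
  (Nc≈1 : CommutativeRing._≈_ R (FieldDefs.norm R p m (gcd m r) c) (CommutativeRing.1# R)) where

  open CommutativeRing R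
  open FieldDefs R
  open PaperDefs R
  open RingArithmetic R
  open Characteristic R pr p≈0
  open FiniteField F
  open IsFiniteField F using (_⁻¹; inverseʳ; 1≉0)
  open GcdSplitting m r (suc n-1) m≥1 gcd≡
  open import Relation.Binary.Reasoning.Setoid setoid
  open import Algebra.Properties.Ring ring using (-‿involutive; x[y-z]≈xy-xz; //-rightDividesʳ; +-inverseʳ-unique)

  private variable
    v x y : Carrier

  n : ℕ
  n = suc n-1

  instance
    p≢0 : NonZero p
    p≢0 = prime⇒nonZero pr

    M≢0 : NonZero M
    M≢0 = ℕ.>-nonZero M≥1

  _∈Fq : Carrier → Set ℓ
  x ∈Fq = frob m x ≈ x

  frob-mn : ∀ x → frob (m ℕ.* n) x ≈ x
  frob-mn x = trans (reflexive (PE.cong (pow x) (PE.sym (ℕP.^-*-assoc p m n)))) (x^N≈x x)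

  ∈Fq-frob : x ∈Fq → ∀ i → frob (m ℕ.* i) x ≈ x
  ∈Fq-frob {x} x∈Fq i = trans (reflexive (PE.cong (λ e → frob e x) (ℕP.*-comm m i))) (frob-multiple x∈Fq i)

  ∈Fq-pow : x ∈Fq → ∀ e → pow x e ∈Fq
  ∈Fq-pow {x} x∈Fq e = trans (frob-pow m x e) (pow-cong x∈Fq e)

  frob-⁻¹ : ∀ k → frob k x ≈ x → ¬ x ≈ 0# → frob k (x ⁻¹) ≈ x ⁻¹
  frob-⁻¹ {x} k fixed x≉0 = *-cancelˡ x≉0 (begin
    x * frob k (x ⁻¹)        ≈⟨ *-congʳ (sym fixed) ⟩
    frob k x * frob k (x ⁻¹) ≈⟨ sym (frob-* k x (x ⁻¹)) ⟩
    frob k (x * x ⁻¹)        ≈⟨ trans (frob-cong k (inverseʳ x x≉0)) (frob-1# k) ⟩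
    1#                       ≈⟨ sym (inverseʳ x x≉0) ⟩
    x * x ⁻¹                 ∎)

  Tr : Carrier → Carrier
  Tr x = sumTo n (λ i → frob (m ℕ.* i) x)

  trace≈Tr : ∀ x → trace (p ℕ.^ m) n 1 x ≈ Tr x
  trace≈Tr x = trans (reflexive (PE.cong (λ t → sumTo t (λ i → pow x ((p ℕ.^ m) ℕ.^ (i ℕ.* 1)))) (ℕDM.n/1≡n n)))
    (sumTo-cong n (λ i → reflexive (PE.cong (pow x)
      (PE.trans (ℕP.^-*-assoc p m (i ℕ.* 1)) (PE.cong (λ t → p ℕ.^ (m ℕ.* t)) (ℕP.*-identityʳ i))))))

  Tr-cong : x ≈ y → Tr x ≈ Tr y
  Tr-cong x≈y = sumTo-cong n (λ i → frob-cong (m ℕ.* i) x≈y)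

  Tr-frob : ∀ k x → Tr (frob k x) ≈ frob k (Tr x)
  Tr-frob k x = trans (sumTo-cong n (λ i → frob-comm (m ℕ.* i) k x)) (sym (frob-sumTo k n _))

  Tr-scalar : ∀ {a} x → a ∈Fq → Tr (a * x) ≈ a * Tr x
  Tr-scalar {a} x a∈Fq = begin
    Tr (a * x)                            ≈⟨ sumTo-cong n (λ i → trans (frob-* (m ℕ.* i) a x) (*-congʳ (∈Fq-frob a∈Fq i))) ⟩
    sumTo n (λ i → a * frob (m ℕ.* i) x)  ≈⟨ sumTo-*ˡ n a _ ⟨
    a * Tr x                              ∎

  Tr-on-Fq : x ∈Fq → Tr x ≈ fromℕ n * x
  Tr-on-Fq x∈Fq = trans (sumTo-cong n (∈Fq-frob x∈Fq)) (sumTo-const n _)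

  Tr-∈Fq : ∀ x → Tr x ∈Fq
  Tr-∈Fq x = begin
    frob m (Tr x)                               ≈⟨ trans (frob-sumTo m n _) (sumTo-cong n shift) ⟩
    sumTo n (λ i → frob (m ℕ.* suc i) x)        ≈⟨ sym (//-rightDividesʳ x _) ⟩
    (sumTo n (λ i → frob (m ℕ.* suc i) x) + x) - x ≈⟨ +-congʳ (trans (+-comm _ _) (+-congʳ (sym frob-m0))) ⟩
    (frob (m ℕ.* 0) x + sumTo n (λ i → frob (m ℕ.* suc i) x)) - x ≈⟨ +-congʳ (sym (sumTo-suc n _)) ⟩
    (Tr x + frob (m ℕ.* n) x) - x               ≈⟨ trans (+-congʳ (+-congˡ (frob-mn x))) (//-rightDividesʳ x _) ⟩
    Tr x                                        ∎
    where
    shift : ∀ i → frob m (frob (m ℕ.* i) x) ≈ frob (m ℕ.* suc i) x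
    shift i = trans (sym (frob-∘ (m ℕ.* i) m x))
      (reflexive (PE.cong (λ e → frob e x) (PE.trans (ℕP.+-comm (m ℕ.* i) m) (PE.sym (ℕP.*-suc m i)))))
    frob-m0 : frob (m ℕ.* 0) x ≈ x
    frob-m0 = trans (reflexive (PE.cong (λ e → frob e x) (ℕP.*-zeroʳ m))) (frob-identity x)

  Ker : Carrier → Set ℓ
  Ker = KerTr (p ℕ.^ m) n

  Tr≈0⇒Ker : Tr x ≈ 0# → Ker x
  Tr≈0⇒Ker {x} = trans (trace≈Tr x)

  Ker⇒Tr≈0 : Ker x → Tr x ≈ 0#
  Ker⇒Tr≈0 {x} = trans (sym (trace≈Tr x))

  Ker-cong : x ≈ y → Ker x → Ker y
  Ker-cong x≈y x∈K = Tr≈0⇒Ker (trans (Tr-cong (sym x≈y)) (Ker⇒Tr≈0 x∈K))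

  Ker-0# : Ker 0#
  Ker-0# = Tr≈0⇒Ker (sumTo-zero n _ (λ i _ → frob-0# (m ℕ.* i)))

  Ker-− : Ker x → Ker y → Ker (x - y)
  Ker-− {x} {y} x∈K y∈K = Tr≈0⇒Ker (begin
    Tr (x - y)     ≈⟨ trans (sumTo-cong n (λ i → frob-− (m ℕ.* i) x y)) (sumTo-− n _ _) ⟩
    Tr x - Tr y    ≈⟨ +-cong (Ker⇒Tr≈0 x∈K) (-‿cong (Ker⇒Tr≈0 y∈K)) ⟩
    0# - 0#        ≈⟨ -‿inverseʳ 0# ⟩
    0#             ∎)

  Ker-scalar : ∀ {a} → a ∈Fq → Ker x → Ker (a * x)
  Ker-scalar {x} {a} a∈Fq x∈K = Tr≈0⇒Ker (trans (Tr-scalar x a∈Fq) (trans (*-congˡ (Ker⇒Tr≈0 x∈K)) (zeroʳ a)))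

  Ker-frob : ∀ k → Ker x → Ker (frob k x)
  Ker-frob {x} k x∈K = Tr≈0⇒Ker (trans (Tr-frob k x) (trans (frob-cong k (Ker⇒Tr≈0 x∈K)) (frob-0# k)))

  Ker-sumTo : ∀ k f → (∀ i → Ker (f i)) → Ker (sumTo k f)
  Ker-sumTo k f f∈K = Tr≈0⇒Ker (trans
    (trans (sumTo-cong n (λ i → frob-sumTo (m ℕ.* i) k f)) (sumTo-comm n k (λ i j → frob (m ℕ.* i) (f j))))
    (sumTo-zero k _ (λ i _ → Ker⇒Tr≈0 (f∈K i))))

  2≤p^ : ∀ k → k ℕ.≥ 1 → 2 ℕ.≤ p ℕ.^ k
  2≤p^ k k≥1 = ℕP.≤-trans (prime⇒2≤ pr) (PE.subst (ℕ._≤ p ℕ.^ k) (ℕP.*-identityʳ p) (ℕP.^-monoʳ-≤ p k≥1))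

  b : ℕ
  b = p ℕ.^ r

  G : ℕ → ℕ
  G = geom b

  c^geom≈1 : pow c (geom (p ℕ.^ d) M) ≈ 1#
  c^geom≈1 = trans (reflexive (PE.cong (pow c) (PE.sym exponent))) Nc≈1
    where
    exponent : divℕ (p ℕ.^ m ℕ.∸ 1) (p ℕ.^ d ℕ.∸ 1) ≡ geom (p ℕ.^ d) M
    exponent = PE.trans (PE.cong (λ e → divℕ (p ℕ.^ e ℕ.∸ 1) (p ℕ.^ d ℕ.∸ 1)) m≡d*M)
      (PE.trans (PE.cong (λ e → divℕ (e ℕ.∸ 1) (p ℕ.^ d ℕ.∸ 1)) (PE.sym (ℕP.^-*-assoc p d M)))
        (divℕ-pow∸1≡geom (p ℕ.^ d) M (2≤p^ d (ℕ.>-nonZero⁻¹ d))))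

  c≉0 : ¬ c ≈ 0#
  c≉0 c≈0 = 1≉0 (trans (sym c^geom≈1) (pow-0 (geom (p ℕ.^ d) M) geom≥1′))
    where
    geom≥1′ : geom (p ℕ.^ d) M ℕ.≥ 1
    geom≥1′ = geom≥1 (p ℕ.^ d) M (ℕP.<-trans (ℕ.s≤s ℕ.z≤n) (2≤p^ d (ℕ.>-nonZero⁻¹ d))) M≥1
    pow-0 : ∀ e → e ℕ.≥ 1 → pow c e ≈ 0#
    pow-0 (suc e) _ = trans (*-congʳ c≈0) (zeroˡ _)

  -- r = d s with s a unit mod M, and c is fixed by frob (d M) = frob m: reindexing k ↦ k s turns
  -- N(c) = ∏_{k<M} c^{p^{dk}} into ∏_{k<M} c^{p^{rk}} = c^{(p^{Mr}-1)/(p^r-1)}.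
  c^G[M]≈1 : pow c (G M) ≈ 1#
  c^G[M]≈1 = begin
    pow c (G M)                               ≈⟨ pow-geom c b M ⟩
    ∏ M (λ k → pow c (b ℕ.^ k))               ≈⟨ ∏-cong M (λ k → reflexive (PE.cong (pow c) (b^k≡ k))) ⟩
    ∏ M (λ k → frob (d ℕ.* (k ℕ.* s)) c)      ≈⟨ ∏-reindex-* M s (Cop.sym coprime-M-s) (λ t → frob (d ℕ.* t) c) (frob-*-% {d} {M} c-fixed) ⟩
    ∏ M (λ k → frob (d ℕ.* k) c)              ≈⟨ ∏-cong M (λ k → reflexive (PE.cong (pow c) (PE.sym (ℕP.^-*-assoc p d k)))) ⟩
    ∏ M (λ k → pow c ((p ℕ.^ d) ℕ.^ k))       ≈⟨ pow-geom c (p ℕ.^ d) M ⟨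
    pow c (geom (p ℕ.^ d) M)                  ≈⟨ c^geom≈1 ⟩
    1#                                        ∎
    where
    open BigOperator *-commutativeMonoid using (∏; ∏-cong; ∏-reindex-*)
    b^k≡ : ∀ k → b ℕ.^ k ≡ p ℕ.^ (d ℕ.* (k ℕ.* s))
    b^k≡ k = PE.trans (ℕP.^-*-assoc p r k) (PE.cong (p ℕ.^_) (PE.trans (PE.cong (ℕ._* k) r≡d*s) (rearrange d s k)))
      where
      rearrange : ∀ d s k → d ℕ.* s ℕ.* k ≡ d ℕ.* (k ℕ.* s)
      rearrange = solve-∀
    c-fixed : frob (d ℕ.* M) c ≈ c
    c-fixed = trans (reflexive (PE.cong (λ e → frob e c) (PE.sym m≡d*M))) c∈Fq

  w : Carrier
  w = c ⁻¹

  c*w≈1 : c * w ≈ 1#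
  c*w≈1 = inverseʳ c c≉0

  w∈Fq : w ∈Fq
  w∈Fq = frob-⁻¹ m c∈Fq c≉0

  w^e*c^e≈1 : ∀ e → pow w e * pow c e ≈ 1#
  w^e*c^e≈1 e = trans (sym (pow-distrib-* w c e)) (trans (pow-cong (trans (*-comm w c) c*w≈1) e) (pow-1# e))

  w^G[M]≈1 : pow w (G M) ≈ 1#
  w^G[M]≈1 = trans (sym (*-identityʳ _)) (trans (*-congˡ (sym c^G[M]≈1)) (w^e*c^e≈1 (G M)))

  L : Carrier → Carrier
  L = Lmap p r c

  L-cong : x ≈ y → L x ≈ L y
  L-cong x≈y = +-cong (frob-cong r x≈y) (-‿cong (*-congˡ x≈y))

  Φ : Carrier → Carrier
  Φ = frob (m ℕ.* s)

  δ : Carrier → Carrier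
  δ u = Φ u - u

  frob[M*r]≈Φ : ∀ u → frob (M ℕ.* r) u ≈ Φ u
  frob[M*r]≈Φ u = reflexive (PE.cong (λ e → frob e u) M*r≡m*s)
    where
    rearrange : ∀ M d s → M ℕ.* (d ℕ.* s) ≡ d ℕ.* M ℕ.* s
    rearrange = solve-∀
    M*r≡m*s : M ℕ.* r ≡ m ℕ.* s
    M*r≡m*s = PE.trans (PE.cong (M ℕ.*_) r≡d*s) (PE.trans (rearrange M d s) (PE.cong (ℕ._* s) (PE.sym m≡d*M)))

  frob-r∘frob-jr : ∀ j u → frob r (frob (j ℕ.* r) u) ≈ frob (suc j ℕ.* r) u
  frob-r∘frob-jr j u = trans (sym (frob-∘ (j ℕ.* r) r u)) (reflexive (PE.cong (λ e → frob e u) (ℕP.+-comm (j ℕ.* r) r)))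

  c*[w*x]≈x : ∀ x → c * (w * x) ≈ x
  c*[w*x]≈x x = trans (sym (*-assoc _ _ _)) (trans (*-congʳ c*w≈1) (*-identityˡ x))

  Z : Carrier → Carrier
  Z v = sumTo M (λ j → pow w (G (suc j)) * frob (j ℕ.* r) v)

  Z-cong : x ≈ y → Z x ≈ Z y
  Z-cong x≈y = sumTo-cong M (λ j → *-congˡ (frob-cong (j ℕ.* r) x≈y))

  -- Both identities telescope: frob r shifts the j-th term of Z to the (j+1)-st, up to the factor c,
  -- because G (j + 2) = b G (j + 1) + 1; the boundary terms match since w ^ G M = 1.
  L∘Z≈δ : ∀ v → L (Z v) ≈ δ v
  L∘Z≈δ v = begin
    frob r (Z v) - c * Z v                  ≈⟨ +-cong (trans (frob-sumTo r M _) (sumTo-cong M shift)) (-‿cong (sumTo-*ˡ M c _)) ⟩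
    sumTo M (λ j → t (suc j)) - sumTo M t   ≈⟨ sumTo-− M _ _ ⟨
    sumTo M (λ j → t (suc j) - t j)         ≈⟨ sumTo-telescope M t ⟩
    t M - t 0                               ≈⟨ +-cong (trans (*-congˡ (*-congʳ w^G[M+1]≈w)) (c*[w*x]≈x _)) (-‿cong t0≈v) ⟩
    frob (M ℕ.* r) v - v                    ≈⟨ +-congʳ (frob[M*r]≈Φ v) ⟩
    δ v                                     ∎
    where
    t : ℕ → Carrier
    t j = c * (pow w (G (suc j)) * frob (j ℕ.* r) v)
    shift : ∀ j → frob r (pow w (G (suc j)) * frob (j ℕ.* r) v) ≈ t (suc j)
    shift j = begin
      frob r (pow w (G (suc j)) * frob (j ℕ.* r) v)        ≈⟨ trans (frob-* r _ _) (*-cong (sym (pow-* w (G (suc j)) b)) (frob-r∘frob-jr j v)) ⟩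
      pow w (G (suc j) ℕ.* b) * frob (suc j ℕ.* r) v       ≈⟨ *-congʳ (sym (c*[w*x]≈x _)) ⟩
      (c * pow w (suc (G (suc j) ℕ.* b))) * frob (suc j ℕ.* r) v ≈⟨ *-assoc _ _ _ ⟩
      c * (pow w (suc (G (suc j) ℕ.* b)) * frob (suc j ℕ.* r) v)
        ≈⟨ *-congˡ (*-congʳ (reflexive (PE.cong (pow w) (PE.trans (ℕP.+-comm 1 _) (geom-suc b (suc j)))))) ⟩
      t (suc j)                                            ∎
    w^G[M+1]≈w : pow w (G (suc M)) ≈ w
    w^G[M+1]≈w = begin
      pow w (G (suc M))              ≈⟨ reflexive (PE.cong (pow w) (PE.trans (PE.sym (geom-suc b M)) (ℕP.+-comm _ 1))) ⟩
      w * pow w (G M ℕ.* b)          ≈⟨ *-congˡ (trans (pow-* w (G M) b) (trans (pow-cong w^G[M]≈1 b) (pow-1# b))) ⟩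
      w * 1#                         ≈⟨ *-identityʳ w ⟩
      w                              ∎
    t0≈v : t 0 ≈ v
    t0≈v = trans (*-congˡ (*-cong (*-identityʳ w) (*-identityʳ v))) (c*[w*x]≈x v)

  Z∘L≈δ : ∀ u → Z (L u) ≈ δ u
  Z∘L≈δ u = begin
    Z (frob r u - c * u)             ≈⟨ sumTo-cong M term ⟩
    sumTo M (λ j → t (suc j) - t j)  ≈⟨ sumTo-telescope M t ⟩
    t M - t 0                        ≈⟨ +-cong (trans (*-congʳ w^G[M]≈1) (*-identityˡ _)) (-‿cong (trans (*-identityˡ _) (frob-identity u))) ⟩
    frob (M ℕ.* r) u - u             ≈⟨ +-congʳ (frob[M*r]≈Φ u) ⟩
    δ u                              ∎
    where
    t : ℕ → Carrier
    t j = pow w (G j) * frob (j ℕ.* r) u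
    coefficient : ∀ j → pow w (G (suc j)) * frob (j ℕ.* r) c ≈ pow w (G j)
    coefficient j = begin
      pow w (G j ℕ.+ b ℕ.^ j) * frob (j ℕ.* r) c
        ≈⟨ *-cong (pow-+ w (G j) (b ℕ.^ j)) (reflexive (PE.cong (pow c) (PE.trans (PE.cong (p ℕ.^_) (ℕP.*-comm j r)) (PE.sym (ℕP.^-*-assoc p r j))))) ⟩
      (pow w (G j) * pow w (b ℕ.^ j)) * pow c (b ℕ.^ j) ≈⟨ trans (*-assoc _ _ _) (*-congˡ (w^e*c^e≈1 (b ℕ.^ j))) ⟩
      pow w (G j) * 1#                                  ≈⟨ *-identityʳ _ ⟩
      pow w (G j)                                       ∎
    term : ∀ j → pow w (G (suc j)) * frob (j ℕ.* r) (frob r u - c * u) ≈ t (suc j) - t j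
    term j = begin
      pow w (G (suc j)) * frob (j ℕ.* r) (frob r u - c * u)
        ≈⟨ trans (*-congˡ (frob-− (j ℕ.* r) _ _)) (x[y-z]≈xy-xz _ _ _) ⟩
      pow w (G (suc j)) * frob (j ℕ.* r) (frob r u) - pow w (G (suc j)) * frob (j ℕ.* r) (c * u)
        ≈⟨ +-cong (*-congˡ (trans (frob-comm (j ℕ.* r) r u) (frob-r∘frob-jr j u)))
                  (-‿cong (trans (*-congˡ (frob-* (j ℕ.* r) c u)) (trans (sym (*-assoc _ _ _)) (*-congʳ (coefficient j))))) ⟩
      t (suc j) - t j ∎

  Φ^ : ℕ → Carrier → Carrier
  Φ^ k = frob (m ℕ.* (k ℕ.* s))

  Φ∘Φ^ : ∀ k y → Φ (Φ^ k y) ≈ Φ^ (suc k) y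
  Φ∘Φ^ k y = trans (sym (frob-∘ (m ℕ.* (k ℕ.* s)) (m ℕ.* s) y)) (reflexive (PE.cong (λ e → frob e y) (rearrange m k s)))
    where
    rearrange : ∀ m k s → m ℕ.* (k ℕ.* s) ℕ.+ m ℕ.* s ≡ m ℕ.* (suc k ℕ.* s)
    rearrange = solve-∀

  Φ^0 : ∀ y → Φ^ 0 y ≈ y
  Φ^0 y = trans (reflexive (PE.cong (λ e → frob e y) (ℕP.*-zeroʳ m))) (frob-identity y)

  Φ^n : ∀ y → Φ^ n y ≈ y
  Φ^n y = trans (reflexive (PE.cong (λ e → frob e y) (rearrange m n s))) (frob-multiple (frob-mn y) s)
    where
    rearrange : ∀ m n s → m ℕ.* (n ℕ.* s) ≡ s ℕ.* (m ℕ.* n)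
    rearrange = solve-∀

  -- Φ = frob (m s) generates the Galois group since s is a unit mod n.
  sumTo-Φ^≈Tr : ∀ y → sumTo n (λ k → Φ^ k y) ≈ Tr y
  sumTo-Φ^≈Tr y = begin
    sumTo n (λ k → Φ^ k y)                  ≈⟨ sumTo≈∑ n _ ⟩
    ∑ n (λ k → frob (m ℕ.* (k ℕ.* s)) y)    ≈⟨ ∏-reindex-* n s coprime-s-n (λ k → frob (m ℕ.* k) y) (frob-*-% {m} {n} (frob-mn y)) ⟩
    ∑ n (λ k → frob (m ℕ.* k) y)            ≈⟨ sumTo≈∑ n _ ⟨
    Tr y                                    ∎
    where open BigOperator +-commutativeMonoid using (∏-reindex-*) renaming (∏ to ∑)

  Ker-L : Ker x → Ker (L x)
  Ker-L x∈K = Ker-− (Ker-frob r x∈K) (Ker-scalar c∈Fq x∈K)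

  Ker-Z : Ker v → Ker (Z v)
  Ker-Z v∈K = Ker-sumTo M _ (λ j → Ker-scalar (∈Fq-pow w∈Fq (G (suc j))) (Ker-frob (j ℕ.* r) v∈K))

  L-scalar : ∀ β X → frob r β ≈ β → β * L X ≈ L (β * X)
  L-scalar β X fixed = begin
    β * (frob r X - c * X)           ≈⟨ x[y-z]≈xy-xz β _ _ ⟩
    β * frob r X - β * (c * X)       ≈⟨ +-cong (*-congʳ (sym fixed)) (-‿cong (trans (sym (*-assoc _ _ _)) (trans (*-congʳ (*-comm β c)) (*-assoc _ _ _)))) ⟩
    frob r β * frob r X - c * (β * X) ≈⟨ +-congʳ (sym (frob-* r β X)) ⟩
    frob r (β * X) - c * (β * X)     ∎

  sumTo-L : ∀ k f → sumTo k (λ i → L (f i)) ≈ L (sumTo k f)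
  sumTo-L k f = trans (sumTo-− k _ _) (+-cong (sym (frob-sumTo r k f)) (-‿cong (sym (sumTo-*ˡ k c f))))

  Φ^-L : ∀ k y → Φ^ k (L y) ≈ L (Φ^ k y)
  Φ^-L k y = begin
    frob e (frob r y - c * y)          ≈⟨ frob-− e _ _ ⟩
    frob e (frob r y) - frob e (c * y) ≈⟨ +-cong (frob-comm e r y) (-‿cong (trans (frob-* e c y) (*-congʳ (∈Fq-frob c∈Fq (k ℕ.* s))))) ⟩
    frob r (frob e y) - c * frob e y   ∎
    where
    e : ℕ
    e = m ℕ.* (k ℕ.* s)

  module Invertible (p∤n : ¬ p ∣ n) where

    n≉0 : ¬ fromℕ n ≈ 0#
    n≉0 = p∤k⇒fromℕ≉0 1≉0 p∤n

    n⁻¹ : Carrier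
    n⁻¹ = fromℕ n ⁻¹

    frob-n⁻¹ : ∀ k → frob k n⁻¹ ≈ n⁻¹
    frob-n⁻¹ k = frob-⁻¹ k (frob-fromℕ k n) n≉0

    U : Carrier → Carrier
    U y = n⁻¹ * sumTo n-1 (λ i → fromℕ (suc i) * Φ^ (suc i) y)

    U-cong : x ≈ y → U x ≈ U y
    U-cong x≈y = *-congˡ (sumTo-cong n-1 (λ i → *-congˡ (frob-cong (m ℕ.* (suc i ℕ.* s)) x≈y)))

    Ker-U : Ker y → Ker (U y)
    Ker-U y∈K = Ker-scalar (frob-n⁻¹ m) (Ker-sumTo n-1 _ (λ i →
      Ker-scalar (frob-fromℕ m (suc i)) (Ker-frob (m ℕ.* (suc i ℕ.* s)) y∈K)))

    -- U y = n⁻¹ Σ_{k<n} k Φ^k y, and Abel summation gives Φ (U y) - U y = n⁻¹ (n y - Tr y).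
    δ∘U≈id : Ker y → δ (U y) ≈ y
    δ∘U≈id {y} y∈K = begin
      Φ (U y) - U y              ≈⟨ +-congʳ ΦU ⟩
      n⁻¹ * S′ - n⁻¹ * S         ≈⟨ x[y-z]≈xy-xz n⁻¹ S′ S ⟨
      n⁻¹ * (S′ - S)             ≈⟨ *-congˡ S′-S≈ny ⟩
      n⁻¹ * (fromℕ n * y)        ≈⟨ trans (sym (*-assoc _ _ _)) (*-congʳ (inverseˡ (fromℕ n) n≉0)) ⟩
      1# * y                     ≈⟨ *-identityˡ y ⟩
      y                          ∎
      where
      t : ℕ → Carrier
      t i = Φ^ (suc i) y
      S S′ : Carrier
      S  = sumTo n-1 (λ i → fromℕ (suc i) * t i)
      S′ = sumTo n-1 (λ i → fromℕ (suc i) * t (suc i))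
      ΦU : Φ (U y) ≈ n⁻¹ * S′
      ΦU = trans (frob-* (m ℕ.* s) n⁻¹ S) (*-cong (frob-n⁻¹ (m ℕ.* s)) (trans (frob-sumTo (m ℕ.* s) n-1 _)
             (sumTo-cong n-1 (λ i → trans (frob-* (m ℕ.* s) _ _) (*-cong (frob-fromℕ (m ℕ.* s) (suc i)) (Φ∘Φ^ (suc i) y))))))
      sumTo-t : sumTo n-1 t ≈ - y
      sumTo-t = +-inverseʳ-unique y _ (begin
        y + sumTo n-1 t           ≈⟨ +-congʳ (sym (Φ^0 y)) ⟩
        Φ^ 0 y + sumTo n-1 t      ≈⟨ sumTo-suc n-1 (λ k → Φ^ k y) ⟨
        sumTo n (λ k → Φ^ k y)    ≈⟨ sumTo-Φ^≈Tr y ⟩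
        Tr y                      ≈⟨ Ker⇒Tr≈0 y∈K ⟩
        0#                        ∎)
      S′-S≈ny : S′ - S ≈ fromℕ n * y
      S′-S≈ny = begin
        S′ - S                                    ≈⟨ sumTo-− n-1 _ _ ⟨
        sumTo n-1 (λ i → fromℕ (suc i) * t (suc i) - fromℕ (suc i) * t i)
          ≈⟨ sumTo-cong n-1 (λ i → sym (x[y-z]≈xy-xz _ _ _)) ⟩
        sumTo n-1 (λ i → fromℕ (suc i) * (t (suc i) - t i)) ≈⟨ sumTo-weighted-telescope n-1 t ⟩
        fromℕ n-1 * t n-1 - sumTo n-1 t            ≈⟨ +-cong (*-congˡ (Φ^n y)) (trans (-‿cong sumTo-t) (-‿involutive y)) ⟩
        fromℕ n-1 * y + y                          ≈⟨ trans (+-comm _ _) (+-congʳ (sym (*-identityˡ y))) ⟩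
        1# * y + fromℕ n-1 * y                     ≈⟨ distribʳ _ _ _ ⟨
        fromℕ n * y                                ∎

    U∘L≈L∘U : ∀ y → U (L y) ≈ L (U y)
    U∘L≈L∘U y = begin
      n⁻¹ * sumTo n-1 (λ i → fromℕ (suc i) * Φ^ (suc i) (L y))
        ≈⟨ *-congˡ (sumTo-cong n-1 (λ i → trans (*-congˡ (Φ^-L (suc i) y)) (L-scalar _ _ (frob-fromℕ r (suc i))))) ⟩
      n⁻¹ * sumTo n-1 (λ i → L (fromℕ (suc i) * Φ^ (suc i) y)) ≈⟨ *-congˡ (sumTo-L n-1 _) ⟩
      n⁻¹ * L (sumTo n-1 (λ i → fromℕ (suc i) * Φ^ (suc i) y)) ≈⟨ L-scalar n⁻¹ _ (frob-n⁻¹ r) ⟩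
      L (U y)                                                   ∎

    L⁻¹ : Carrier → Carrier
    L⁻¹ = invPoly _⁻¹ p m n r d c

    L⁻¹≈Z∘U : ∀ y → L⁻¹ y ≈ Z (U y)
    L⁻¹≈Z∘U y = trans
      (reflexive (PE.cong (λ k → sumTo k (λ j → pow w (divℕ (p ℕ.^ (suc j ℕ.* r) ℕ.∸ 1) (b ℕ.∸ 1)) * frob (j ℕ.* r) inner)) (divℕ≡/ m d)))
      (sumTo-cong M (λ j → *-cong (reflexive (PE.cong (pow w) (w-exponent j))) (frob-cong (j ℕ.* r) inner≈U)))
      where
      inner : Carrier
      inner = n⁻¹ * sumTo n-1 (λ i → fromℕ (suc i) * pow y (p ℕ.^ divℕ (suc i ℕ.* m ℕ.* r) d))
      rearrange : ∀ i m d s → i ℕ.* m ℕ.* (d ℕ.* s) ≡ m ℕ.* (i ℕ.* s) ℕ.* d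
      rearrange = solve-∀
      exponent : ∀ i → divℕ (suc i ℕ.* m ℕ.* r) d ≡ m ℕ.* (suc i ℕ.* s)
      exponent i = PE.trans (divℕ≡/ _ d) (PE.trans (PE.cong (_/ d) (PE.trans (PE.cong (suc i ℕ.* m ℕ.*_) r≡d*s) (rearrange (suc i) m d s)))
        (ℕDM.m*n/n≡m (m ℕ.* (suc i ℕ.* s)) d))
      inner≈U : inner ≈ U y
      inner≈U = *-congˡ (sumTo-cong n-1 (λ i → *-congˡ (reflexive (PE.cong (λ e → pow y (p ℕ.^ e)) (exponent i)))))
      w-exponent : ∀ j → divℕ (p ℕ.^ (suc j ℕ.* r) ℕ.∸ 1) (b ℕ.∸ 1) ≡ G (suc j)
      w-exponent j = PE.trans (PE.cong (λ e → divℕ (e ℕ.∸ 1) (b ℕ.∸ 1))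
                                 (PE.trans (PE.cong (p ℕ.^_) (ℕP.*-comm (suc j) r)) (PE.sym (ℕP.^-*-assoc p r (suc j)))))
                      (divℕ-pow∸1≡geom b (suc j) (2≤p^ r r≥1))

    Ker-L⁻¹ : Ker y → Ker (L⁻¹ y)
    Ker-L⁻¹ {y} y∈K = Ker-cong (sym (L⁻¹≈Z∘U y)) (Ker-Z (Ker-U y∈K))

    L∘L⁻¹≈id : Ker y → L (L⁻¹ y) ≈ y
    L∘L⁻¹≈id {y} y∈K = begin
      L (L⁻¹ y)   ≈⟨ L-cong (L⁻¹≈Z∘U y) ⟩
      L (Z (U y)) ≈⟨ L∘Z≈δ (U y) ⟩
      δ (U y)     ≈⟨ δ∘U≈id y∈K ⟩
      y           ∎

    L⁻¹∘L≈id : Ker y → L⁻¹ (L y) ≈ y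
    L⁻¹∘L≈id {y} y∈K = begin
      L⁻¹ (L y)   ≈⟨ L⁻¹≈Z∘U (L y) ⟩
      Z (U (L y)) ≈⟨ Z-cong (U∘L≈L∘U y) ⟩
      Z (L (U y)) ≈⟨ Z∘L≈δ (U y) ⟩
      δ (U y)     ≈⟨ δ∘U≈id y∈K ⟩
      y           ∎

    L-permutes-Ker : InducesPermutation Ker L
    L-permutes-Ker =
        (λ x x∈K → Ker-L x∈K)
      , (λ x y x∈K y∈K Lx≈Ly → trans (sym (L⁻¹∘L≈id x∈K)) (trans (L⁻¹-cong Lx≈Ly) (L⁻¹∘L≈id y∈K)))
      , (λ y y∈K → L⁻¹ y , Ker-L⁻¹ y∈K , L∘L⁻¹≈id y∈K)
      where
      L⁻¹-cong : x ≈ y → L⁻¹ x ≈ L⁻¹ y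
      L⁻¹-cong {x} {y} x≈y = trans (L⁻¹≈Z∘U x) (trans (Z-cong (U-cong x≈y)) (sym (L⁻¹≈Z∘U y)))

  ∈Fq-Z : v ∈Fq → Z v ∈Fq
  ∈Fq-Z {v} v∈Fq = trans (frob-sumTo m M _) (sumTo-cong M (λ j → trans (frob-* m _ _)
    (*-cong (∈Fq-pow w∈Fq (G (suc j))) (trans (frob-comm m (j ℕ.* r) v) (frob-cong (j ℕ.* r) v∈Fq)))))

  L-0# : L 0# ≈ 0#
  L-0# = trans (+-cong (frob-0# r) (-‿cong (zeroʳ c))) (-‿inverseʳ 0#)

  module NotInvertible (p∣n : p ∣ n) (L-injective : ∀ x y → Ker x → Ker y → L x ≈ L y → x ≈ y) where

    instance
      m≢0 : NonZero m
      m≢0 = ℕ.>-nonZero m≥1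

      mn≢0 : NonZero (m ℕ.* n)
      mn≢0 = ℕP.m*n≢0 m n

    Z∘Tr≈0 : ∀ x → Z (Tr x) ≈ 0#
    Z∘Tr≈0 x = L-injective (Z tx) 0# Zv∈K Ker-0# (trans (L∘Z≈δ tx) (trans δv≈0 (sym L-0#)))
      where
      tx : Carrier
      tx = Tr x
      Zv∈K : Ker (Z tx)
      Zv∈K = Tr≈0⇒Ker (trans (Tr-on-Fq (∈Fq-Z (Tr-∈Fq x))) (trans (*-congʳ (p∣k⇒fromℕ≈0 p∣n)) (zeroˡ _)))
      δv≈0 : δ tx ≈ 0#
      δv≈0 = trans (+-congʳ (∈Fq-frob (Tr-∈Fq x) s)) (-‿inverseʳ tx)

    α : ℕ → Carrier
    α j = pow w (G (suc j))

    e : ℕ → ℕ → ℕ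
    e i j = (m ℕ.* i ℕ.+ j ℕ.* r) % (m ℕ.* n)

    coefficient : ℕ → Carrier
    coefficient k = sumTo M (λ j → sumTo n (λ i → monomial (p ℕ.^ e i j) (α j) k))

    p^e<q^n : ∀ i j → p ℕ.^ e i j ℕ.< (p ℕ.^ m) ℕ.^ n
    p^e<q^n i j = PE.subst (p ℕ.^ e i j ℕ.<_) (PE.sym (ℕP.^-*-assoc p m n))
      (ℕP.^-monoʳ-< p (prime⇒2≤ pr) (ℕDM.m%n<n (m ℕ.* i ℕ.+ j ℕ.* r) (m ℕ.* n)))

    Z∘Tr≈polynomial : ∀ x → Z (Tr x) ≈ sumTo ((p ℕ.^ m) ℕ.^ n) (λ k → coefficient k * pow x k)
    Z∘Tr≈polynomial x = begin
      Z (Tr x)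
        ≈⟨ sumTo-cong M (λ j → trans (*-congˡ (frob-sumTo (j ℕ.* r) n _)) (trans (sumTo-*ˡ n _ _) (sumTo-cong n (λ i → *-congˡ (reduce i j))))) ⟩
      sumTo M (λ j → sumTo n (λ i → α j * pow x (p ℕ.^ e i j)))
        ≈⟨ sumTo-cong M (λ j → sumTo-cong n (λ i → sym (sumTo-monomial Q (p ℕ.^ e i j) (α j) (pow x) (p^e<q^n i j)))) ⟩
      sumTo M (λ j → sumTo n (λ i → sumTo Q (λ k → monomial (p ℕ.^ e i j) (α j) k * pow x k)))
        ≈⟨ trans (sumTo-cong M (λ j → sym (sumTo-comm Q n _))) (sym (sumTo-comm Q M _)) ⟩
      sumTo Q (λ k → sumTo M (λ j → sumTo n (λ i → monomial (p ℕ.^ e i j) (α j) k * pow x k)))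
        ≈⟨ sumTo-cong Q (λ k → sym (trans (sumTo-*ʳ M _ _) (sumTo-cong M (λ j → sumTo-*ʳ n _ _)))) ⟩
      sumTo Q (λ k → coefficient k * pow x k) ∎
      where
      Q : ℕ
      Q = (p ℕ.^ m) ℕ.^ n
      reduce : ∀ i j → frob (j ℕ.* r) (frob (m ℕ.* i) x) ≈ pow x (p ℕ.^ e i j)
      reduce i j = trans (sym (frob-∘ (m ℕ.* i) (j ℕ.* r) x)) (frob-% (frob-mn x) (m ℕ.* i ℕ.+ j ℕ.* r))

    p^e≡1⇒i≡0×j≡0 : ∀ {i j} → i ℕ.< n → j ℕ.< M → p ℕ.^ e i j ≡ 1 → i ≡ 0 × j ≡ 0
    p^e≡1⇒i≡0×j≡0 {i} {j} i<n j<M p^e≡1 = i≡0 , j≡0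
      where
      e≡0 : e i j ≡ 0
      e≡0 with ℕP.m^n≡1⇒n≡0∨m≡1 p (e i j) p^e≡1
      ... | inj₁ e≡0 = e≡0
      ... | inj₂ p≡1 = contradiction (PE.subst (2 ℕ.≤_) p≡1 (prime⇒2≤ pr)) (λ { (ℕ.s≤s ()) })
      mn∣ : m ℕ.* n ∣ m ℕ.* i ℕ.+ j ℕ.* r
      mn∣ = ℕD.m%n≡0⇒n∣m _ (m ℕ.* n) e≡0
      multiple-below⇒0 : ∀ {k l} → k ∣ l → l ℕ.< k → l ≡ 0
      multiple-below⇒0 {k} {zero}  _   _   = PE.refl
      multiple-below⇒0 {k} {suc l} k∣l l<k = contradiction k∣l (ℕD.>⇒∤ l<k)
      rearrange : ∀ j d s → j ℕ.* (d ℕ.* s) ≡ d ℕ.* (s ℕ.* j)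
      rearrange = solve-∀
      M∣j : M ∣ j
      M∣j = Cop.coprime-divisor coprime-M-s (ℕD.*-cancelˡ-∣ d (PE.subst₂ _∣_ m≡d*M
        (PE.trans (PE.cong (j ℕ.*_) r≡d*s) (rearrange j d s))
        (ℕD.∣m+n∣m⇒∣n (ℕD.∣-trans (ℕD.m∣m*n n) mn∣) (ℕD.m∣m*n i))))
      j≡0 : j ≡ 0
      j≡0 = multiple-below⇒0 M∣j j<M
      i≡0 : i ≡ 0
      i≡0 = multiple-below⇒0 (ℕD.*-cancelˡ-∣ m (PE.subst (m ℕ.* n ∣_)
        (PE.trans (PE.cong (λ z → m ℕ.* i ℕ.+ z ℕ.* r) j≡0) (ℕP.+-identityʳ _)) mn∣)) i<n

    coefficient₁≈α₀ : coefficient 1 ≈ α 0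
    coefficient₁≈α₀ = begin
      coefficient 1
        ≈⟨ sumTo-head M _ M≥1 (λ 0<j j<M → sumTo-zero n _ (λ i i<n → only-origin i<n j<M (ℕP.>⇒≢ 0<j ∘ proj₂))) ⟩
      sumTo n (λ i → monomial (p ℕ.^ e i 0) (α 0) 1)
        ≈⟨ sumTo-head n _ (ℕ.s≤s ℕ.z≤n) (λ 0<i i<n → only-origin i<n M≥1 (ℕP.>⇒≢ 0<i ∘ proj₁)) ⟩
      monomial (p ℕ.^ e 0 0) (α 0) 1                   ≈⟨ reflexive (PE.cong (λ k → monomial (p ℕ.^ k) (α 0) 1) e00≡0) ⟩
      monomial 1 (α 0) 1                               ≈⟨ monomial-≡ 1 (α 0) ⟩
      α 0                                              ∎
      where
      only-origin : ∀ {i j} → i ℕ.< n → j ℕ.< M → ¬ (i ≡ 0 × j ≡ 0) → monomial (p ℕ.^ e i j) (α j) 1 ≈ 0#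
      only-origin i<n j<M not-origin = monomial-≢ _ (not-origin ∘ p^e≡1⇒i≡0×j≡0 i<n j<M ∘ PE.sym)
      e00≡0 : e 0 0 ≡ 0
      e00≡0 = PE.trans (PE.cong (_% (m ℕ.* n)) (PE.trans (ℕP.+-identityʳ (m ℕ.* 0)) (ℕP.*-zeroʳ m))) (ℕDM.m*n%n≡0 0 (m ℕ.* n))

    absurd : ⊥
    absurd = 1≉0 (begin
      1#                 ≈⟨ sym c*w≈1 ⟩
      c * w              ≈⟨ *-congˡ (sym (*-identityʳ w)) ⟩
      c * α 0            ≈⟨ *-congˡ (trans (sym coefficient₁≈α₀) coefficient₁≈0) ⟩
      c * 0#             ≈⟨ zeroʳ c ⟩
      0#                 ∎)
      where
      coefficient₁≈0 : coefficient 1 ≈ 0#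
      coefficient₁≈0 = vanishing-polynomial⇒zero coefficient (λ x → trans (sym (Z∘Tr≈polynomial x)) (Z∘Tr≈0 x))
        (PE.subst (1 ℕ.<_) (PE.sym (ℕP.^-*-assoc p m n)) (2≤p^ (m ℕ.* n) (ℕP.*-mono-≤ m≥1 (ℕ.s≤s ℕ.z≤n))))

open import Data.Nat.Base using (_*_; _^_; _≥_)

theorem2p5 : {a ℓ : Level} (R : CommutativeRing a ℓ) (p m n r : ℕ) →
    Prime p → m ≥ 1 → n ≥ 1 → r ≥ 1 →
    gcd (n * m) r ≡ gcd m r →
    (F : IsFiniteField R ((p ^ m) ^ n)) →
    CommutativeRing._≈_ R (FieldDefs.fromℕ R p) (CommutativeRing.0# R) →
    (c : CommutativeRing.Carrier R) →
    CommutativeRing._≈_ R (FieldDefs.pow R c (p ^ m)) c →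
    CommutativeRing._≈_ R (FieldDefs.norm R p m (gcd m r) c) (CommutativeRing.1# R) →
    ((FieldDefs.InducesPermutation R (PaperDefs.KerTr R (p ^ m) n) (PaperDefs.Lmap R p r c)
        → ¬ (p ∣ n)) ×
     (¬ (p ∣ n)
        → FieldDefs.InducesPermutation R (PaperDefs.KerTr R (p ^ m) n) (PaperDefs.Lmap R p r c)))
    ×
    (¬ (p ∣ n) → ∀ y → PaperDefs.KerTr R (p ^ m) n y →
       PaperDefs.KerTr R (p ^ m) n
         (PaperDefs.invPoly R (IsFiniteField._⁻¹ F) p m n r (gcd m r) c y) ×
       CommutativeRing._≈_ R
         (PaperDefs.Lmap R p r c (PaperDefs.invPoly R (IsFiniteField._⁻¹ F) p m n r (gcd m r) c y)) y ×
       CommutativeRing._≈_ R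
         (PaperDefs.invPoly R (IsFiniteField._⁻¹ F) p m n r (gcd m r) c (PaperDefs.Lmap R p r c y)) y)
theorem2p5 R p m zero      r pr m≥1 ()  r≥1 gcd≡ F p≈0 c c∈Fq Nc≈1
theorem2p5 R p m (suc n-1) r pr m≥1 n≥1 r≥1 gcd≡ F p≈0 c c∈Fq Nc≈1 =
    ( (λ L-permutes p∣n → NotInvertible.absurd p∣n (proj₁ (proj₂ L-permutes)))
    , Invertible.L-permutes-Ker )
  , λ p∤n y y∈K → let open Invertible p∤n in Ker-L⁻¹ y∈K , L∘L⁻¹≈id y∈K , L⁻¹∘L≈id y∈K
  where open TraceKernel R p m n-1 r pr m≥1 r≥1 gcd≡ F p≈0 c c∈Fq Nc≈1
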